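{- Let $w$ be a non-empty finite word with heart $v$. If $|w|=R_v+K_v+|\mathrm{Alph}(w)|-2$, then $\min\{R_v,K_v\}=\min\{L_v,H_v\}$ and $|w|=L_v+H_v+|\mathrm{Alph}(w)|-2$.
   Context: Words are finite sequences of letters; $|w|$ is the length and $\mathrm{Alph}(w)$ the set of letters of $w$. A factor is a contiguous subword. A factor $u$ of $w$ is right special (resp. left special) if $ux$ (resp. $xu$) is a factor of $w$ for at least two distinct letters $x$. $R_w$ (resp. $L_w$) is the smallest positive integer $r$ such that $w$ has no right special (resp. left special) factor of length $r$. $K_w$ (resp. $H_w$) is the length of the shortest suffix (resp. prefix) of $w$ occurring exactly once in $w$. Heart: for a non-empty word $w$, let $r$ be the longest (possibly empty) prefix of $w$ all of whose letters occur exactly once in $w$, and $s$ the longest (possibly empty) suffix of $w$ all of whose letters occur exactly once in $w$. If $|w|>|\mathrm{Alph}(w)|$, the heart of $w$ is the unique non-empty $v$ with $w=rvs$; otherwise the heart of $w$ is $w$. -}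

module Defs where

open import Data.List using (List; []; _∷_; _++_; length; filter; takeWhile; reverse; take; drop; deduplicate)
open import Data.Nat using (ℕ; _≤_; _<_; _∸_)
open import Data.Product using (Σ; ∃; _×_; _,_)
open import Relation.Binary.PropositionalEquality using (_≡_; _≢_)
open import Relation.Binary.Definitions using (DecidableEquality)
open import Relation.Nullary using (¬_)

module _ {A : Set} (_≟_ : DecidableEquality A) where

  alphSize : List A → ℕ
  alphSize w = length (deduplicate _≟_ w)

  count : A → List A → ℕ
  count a w = length (filter (a ≟_) w)

  heart : List A → List A
  heart w with alphSize w Data.Nat.<? length w
  ... | Relation.Nullary.yes _ = drop (length r) (take (length w ∸ length s) w)
    where
      r s : List A
      r = takeWhile (λ a → count a w Data.Nat.≟ 1) w
      s = reverse (takeWhile (λ a → count a w Data.Nat.≟ 1) (reverse w))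
  ... | Relation.Nullary.no _ = w

Factor : {A : Set} → List A → List A → Set
Factor u w = ∃ λ p → ∃ λ s → w ≡ p ++ u ++ s

OccursOnce : {A : Set} → List A → List A → Set
OccursOnce u w = ∃ λ p → ∃ λ s → (w ≡ p ++ u ++ s) ×
  (∀ p' s' → w ≡ p' ++ u ++ s' → length p' ≡ length p)

RightSpecial : {A : Set} → List A → List A → Set
RightSpecial {A} u w = Σ A λ x → Σ A λ y → x ≢ y ×
  Factor (u ++ x ∷ []) w × Factor (u ++ y ∷ []) w

LeftSpecial : {A : Set} → List A → List A → Set
LeftSpecial {A} u w = Σ A λ x → Σ A λ y → x ≢ y ×
  Factor (x ∷ u) w × Factor (y ∷ u) w

HasRSOfLength : {A : Set} → List A → ℕ → Set
HasRSOfLength w n = ∃ λ u → length u ≡ n × RightSpecial u w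

HasLSOfLength : {A : Set} → List A → ℕ → Set
HasLSOfLength w n = ∃ λ u → length u ≡ n × LeftSpecial u w

IsR : {A : Set} → List A → ℕ → Set
IsR w r = 1 ≤ r × ¬ HasRSOfLength w r × (∀ r' → 1 ≤ r' → r' < r → HasRSOfLength w r')

IsL : {A : Set} → List A → ℕ → Set
IsL w l = 1 ≤ l × ¬ HasLSOfLength w l × (∀ l' → 1 ≤ l' → l' < l → HasLSOfLength w l')

UniqueSuffixOfLength : {A : Set} → List A → ℕ → Set
UniqueSuffixOfLength w n = ∃ λ u → length u ≡ n × (∃ λ t → w ≡ t ++ u) × OccursOnce u w

UniquePrefixOfLength : {A : Set} → List A → ℕ → Set
UniquePrefixOfLength w n = ∃ λ u → length u ≡ n × (∃ λ t → w ≡ u ++ t) × OccursOnce u w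

IsK : {A : Set} → List A → ℕ → Set
IsK w k = UniqueSuffixOfLength w k × (∀ k' → k' < k → ¬ UniqueSuffixOfLength w k')

IsH : {A : Set} → List A → ℕ → Set
IsH w h = UniquePrefixOfLength w h × (∀ h' → h' < h → ¬ UniquePrefixOfLength w h')

module Submission where

-- Let v be the heart of w, n = |v| and f(m) the number of distinct factors of
-- v of length m.  Counting right extensions gives, for 1 ≤ m ≤ n, the balance
-- f(m+1) + [K_v ≤ m] = f(m) + E(m), where the excess E(m) ≥ [m < R_v].  Reversal
-- swaps left and right and preserves f, so also f(m+1) + [H_v ≤ m] = f(m) + E'(m)
-- with E'(m) > 0 exactly when m < L_v.  Summing the right balance (f(1) = |Alph v|,
-- f(n+1) = 0) gives n + 2 ≥ R_v + K_v + |Alph v|, with equality only if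
-- E(m) = [m < R_v] for all m; the hypothesis is this equality, since trimming w
-- to v removes as many letters as it removes from the alphabet.  Then f rises
-- strictly below min(R_v, K_v) and falls strictly from max(R_v, K_v) on, and the
-- left balance forces min(L_v, H_v) and max(L_v, H_v) to be the same turning
-- points, provided min(R_v, K_v) ≤ H_v; this holds since either R_v = 1 or the
-- heart starts with a repeated letter and the excess bound E ≤ 1 applies.

open import Defs
open import Data.Empty using (⊥; ⊥-elim)
open import Data.List using (List; []; _∷_; _++_; [_]; initLast; _∷ʳ′_; length; take; drop; reverse; map; head; deduplicate; filter; takeWhile; dropWhile)
open import Data.List.Properties using (length-++; length-map; length-reverse; length-filter; filter-all; filter-none; filter-accept; filter-reject; filter-++; takeWhile++dropWhile; reverse-++; reverse-involutive; ++-assoc; ++-identityʳ; ++-cancelˡ; ≡-dec; ∷-injective; ∷-injectiveʳ; ∷ʳ-injective; take++drop≡id; length-take; length-drop)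
open import Data.List.Membership.Propositional using (_∈_; _∉_)
open import Data.List.Membership.Propositional.Properties using (∈-++⁺ˡ; ∈-++⁺ʳ; ∈-++⁻; ∈-map⁺; ∈-map⁻; ∈-∃++; ∈-deduplicate⁺; ∈-deduplicate⁻)
open import Data.List.Relation.Unary.Any using (here; there)
open import Data.List.Relation.Unary.Any.Properties using (reverse⁺; reverse⁻)
import Data.List.Relation.Unary.All as All
open import Data.List.Relation.Unary.All using (All; []; _∷_)
open import Data.List.Relation.Unary.All.Properties using (All¬⇒¬Any; all-takeWhile; dropWhile⁻; all-head-dropWhile)
open import Data.List.Relation.Unary.Unique.Propositional using (Unique)
open import Data.List.Relation.Unary.Unique.Propositional.Properties using (map⁺)
open import Data.List.Relation.Unary.Unique.DecPropositional.Properties using (deduplicate-!)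
open import Data.List.Relation.Unary.AllPairs using ([]; _∷_)
open import Data.Nat using (ℕ; zero; suc; _+_; _∸_; _≤_; _<_; z≤n; s≤s; _≤?_; _<?_; _⊓_; _⊔_)
open import Data.Nat.Properties
open import Data.Nat.Tactic.RingSolver using (solve-∀)
open import Data.Product using (Σ; ∃; _×_; _,_; proj₁; proj₂)
open import Data.Sum using (_⊎_; inj₁; inj₂; [_,_]′)
open import Relation.Nullary using (¬_; Dec; yes; no)
open import Relation.Nullary.Decidable using (_×-dec_; ¬?)
open import Relation.Binary.PropositionalEquality hiding ([_])
open import Relation.Binary.Definitions using (DecidableEquality; tri<; tri≈; tri>)
open import Relation.Unary using (∁)
import Data.Maybe.Relation.Unary.All as Maybe

-- Finite sums over lists and double counting

𝟙 : {P : Set} → Dec P → ℕ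
𝟙 (yes _) = 1
𝟙 (no _)  = 0

𝟙-yes : {P : Set} (d : Dec P) → P → 𝟙 d ≡ 1
𝟙-yes (yes _) _ = refl
𝟙-yes (no ¬p) p = ⊥-elim (¬p p)

𝟙-no : {P : Set} (d : Dec P) → ¬ P → 𝟙 d ≡ 0
𝟙-no (yes p) ¬p = ⊥-elim (¬p p)
𝟙-no (no _)  _  = refl

𝟙≤1 : {P : Set} (d : Dec P) → 𝟙 d ≤ 1
𝟙≤1 (yes _) = s≤s z≤n
𝟙≤1 (no _)  = z≤n

module _ {B : Set} where

  ∑ : (B → ℕ) → List B → ℕ
  ∑ g []       = 0
  ∑ g (x ∷ xs) = g x + ∑ g xs

  ∑-cong : (g h : B → ℕ) (xs : List B) → (∀ x → x ∈ xs → g x ≡ h x) → ∑ g xs ≡ ∑ h xs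
  ∑-cong g h []       e = refl
  ∑-cong g h (x ∷ xs) e = cong₂ _+_ (e x (here refl)) (∑-cong g h xs (λ y p → e y (there p)))

  ∑-+ : (g h : B → ℕ) (xs : List B) → ∑ (λ x → g x + h x) xs ≡ ∑ g xs + ∑ h xs
  ∑-+ g h []       = refl
  ∑-+ g h (x ∷ xs) rewrite ∑-+ g h xs = interchange (g x) (h x) (∑ g xs) (∑ h xs)
    where
    interchange : ∀ a b c d → a + b + (c + d) ≡ a + c + (b + d)
    interchange = solve-∀

  ∑-zero : (g : B → ℕ) (xs : List B) → (∀ x → x ∈ xs → g x ≡ 0) → ∑ g xs ≡ 0
  ∑-zero g []       e = refl
  ∑-zero g (x ∷ xs) e rewrite e x (here refl) = ∑-zero g xs (λ y p → e y (there p))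

  ∑-one : (xs : List B) → ∑ (λ _ → 1) xs ≡ length xs
  ∑-one []       = refl
  ∑-one (x ∷ xs) = cong suc (∑-one xs)

  ∑-excess-deficit : (g : B → ℕ) (xs : List B) →
                     ∑ g xs + ∑ (λ x → 1 ∸ g x) xs ≡ ∑ (λ x → g x ∸ 1) xs + length xs
  ∑-excess-deficit g xs = begin
    ∑ g xs + ∑ (λ x → 1 ∸ g x) xs       ≡⟨ ∑-+ g (λ x → 1 ∸ g x) xs ⟨
    ∑ (λ x → g x + (1 ∸ g x)) xs        ≡⟨ ∑-cong _ _ xs (λ x _ → pointwise (g x)) ⟩
    ∑ (λ x → (g x ∸ 1) + 1) xs          ≡⟨ ∑-+ (λ x → g x ∸ 1) (λ _ → 1) xs ⟩
    ∑ (λ x → g x ∸ 1) xs + ∑ (λ _ → 1) xs ≡⟨ cong (∑ (λ x → g x ∸ 1) xs +_) (∑-one xs) ⟩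
    ∑ (λ x → g x ∸ 1) xs + length xs    ∎
    where
    open ≡-Reasoning
    pointwise : ∀ k → k + (1 ∸ k) ≡ (k ∸ 1) + 1
    pointwise zero    = refl
    pointwise (suc k) = trans (cong (suc k +_) (0∸n≡0 k)) (trans (+-identityʳ (suc k)) (+-comm 1 k))

  remove : {a : B} (xs : List B) → a ∈ xs → List B
  remove (x ∷ xs) (here _)  = xs
  remove (x ∷ xs) (there p) = x ∷ remove xs p

  ∑-remove : (g : B → ℕ) {a : B} (xs : List B) (p : a ∈ xs) → ∑ g xs ≡ g a + ∑ g (remove xs p)
  ∑-remove g (x ∷ xs) (here refl) = refl
  ∑-remove g {a} (x ∷ xs) (there p) rewrite ∑-remove g xs p = swap (g x) (g a) (∑ g (remove xs p))
    where
    swap : ∀ a b c → a + (b + c) ≡ b + (a + c)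
    swap = solve-∀

  ∈-remove : {a b : B} (xs : List B) (p : a ∈ xs) → b ∈ xs → b ≢ a → b ∈ remove xs p
  ∈-remove (x ∷ xs) (here refl) (here refl) b≢a = ⊥-elim (b≢a refl)
  ∈-remove (x ∷ xs) (here refl) (there q)   b≢a = q
  ∈-remove (x ∷ xs) (there p)   (here refl) b≢a = here refl
  ∈-remove (x ∷ xs) (there p)   (there q)   b≢a = there (∈-remove xs p q b≢a)

  length-remove : {a : B} (xs : List B) (p : a ∈ xs) → length xs ≡ suc (length (remove xs p))
  length-remove (x ∷ xs) (here _)  = refl
  length-remove (x ∷ xs) (there p) = cong suc (length-remove xs p)

  ∑-≥₁ : (g : B → ℕ) {a : B} (xs : List B) → a ∈ xs → g a ≤ ∑ g xs
  ∑-≥₁ g xs p rewrite ∑-remove g xs p = m≤m+n _ _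

  ∑-≥₂ : (g : B → ℕ) {a b : B} (xs : List B) → a ∈ xs → b ∈ xs → b ≢ a → g a + g b ≤ ∑ g xs
  ∑-≥₂ g xs p q b≢a rewrite ∑-remove g xs p = +-monoʳ-≤ _ (∑-≥₁ g (remove xs p) (∈-remove xs p q b≢a))

  ∑-≥₃ : (g : B → ℕ) {a b c : B} (xs : List B) → a ∈ xs → b ∈ xs → c ∈ xs →
         b ≢ a → c ≢ a → c ≢ b → g a + (g b + g c) ≤ ∑ g xs
  ∑-≥₃ g xs p q r b≢a c≢a c≢b rewrite ∑-remove g xs p =
    +-monoʳ-≤ _ (∑-≥₂ g (remove xs p) (∈-remove xs p q b≢a) (∈-remove xs p r c≢a) c≢b)

  unique-⊆-length : (xs ys : List B) → Unique xs → (∀ x → x ∈ xs → x ∈ ys) → length xs ≤ length ys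
  unique-⊆-length []       ys _          _   = z≤n
  unique-⊆-length (x ∷ xs) ys (x∉ ∷ uxs) sub rewrite length-remove ys (sub x (here refl)) =
    s≤s (unique-⊆-length xs (remove ys (sub x (here refl))) uxs
          (λ y p → ∈-remove ys _ (sub y (there p)) (λ { refl → All¬⇒¬Any x∉ p })))

  module _ (_≟_ : DecidableEquality B) where

    ∑-𝟙-absent : (a : B) (xs : List B) → a ∉ xs → ∑ (λ u → 𝟙 (u ≟ a)) xs ≡ 0
    ∑-𝟙-absent a []       _  = refl
    ∑-𝟙-absent a (x ∷ xs) a∉ with x ≟ a
    ... | yes refl = ⊥-elim (a∉ (here refl))
    ... | no _     = ∑-𝟙-absent a xs (λ p → a∉ (there p))

    ∑-𝟙-unique : (a : B) (xs : List B) → Unique xs → a ∈ xs → ∑ (λ u → 𝟙 (u ≟ a)) xs ≡ 1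
    ∑-𝟙-unique a (x ∷ xs) (x∉ ∷ _) (here refl) rewrite 𝟙-yes (x ≟ x) refl =
      cong suc (∑-𝟙-absent x xs (All¬⇒¬Any x∉))
    ∑-𝟙-unique a (x ∷ xs) (x∉ ∷ uxs) (there p) with x ≟ a
    ... | yes refl = ⊥-elim (All¬⇒¬Any x∉ p)
    ... | no _     = ∑-𝟙-unique a xs uxs p

module Fibres {B C : Set} (_≟_ : DecidableEquality B) (g : C → B) where

  fibre : B → List C → ℕ
  fibre u Y = ∑ (λ y → 𝟙 (u ≟ g y)) Y

  ∑-fibre : (X : List B) (Y : List C) → Unique X → (∀ y → y ∈ Y → g y ∈ X) →
            ∑ (λ u → fibre u Y) X ≡ length Y
  ∑-fibre X []      _  _  = ∑-zero _ X (λ _ _ → refl)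
  ∑-fibre X (y ∷ Y) uX gY =
    trans (∑-+ (λ u → 𝟙 (u ≟ g y)) (λ u → fibre u Y) X)
          (cong₂ _+_ (∑-𝟙-unique _≟_ (g y) X uX (gY y (here refl)))
                     (∑-fibre X Y uX (λ z p → gY z (there p))))

  private
    𝟙-hit : ∀ {u y} → g y ≡ u → 1 ≡ 𝟙 (u ≟ g y)
    𝟙-hit e = sym (𝟙-yes (_ ≟ _) (sym e))

  fibre-≥₁ : (u : B) (Y : List C) {a : C} → a ∈ Y → g a ≡ u → 1 ≤ fibre u Y
  fibre-≥₁ u Y p ea = ≤-trans (≤-reflexive (𝟙-hit ea)) (∑-≥₁ _ Y p)

  fibre-≥₂ : (u : B) (Y : List C) {a b : C} → a ∈ Y → b ∈ Y → b ≢ a →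
             g a ≡ u → g b ≡ u → 2 ≤ fibre u Y
  fibre-≥₂ u Y pa pb b≢a ea eb =
    ≤-trans (≤-reflexive (cong₂ _+_ (𝟙-hit ea) (𝟙-hit eb))) (∑-≥₂ _ Y pa pb b≢a)

  fibre-≥₃ : (u : B) (Y : List C) {a b c : C} → a ∈ Y → b ∈ Y → c ∈ Y →
             b ≢ a → c ≢ a → c ≢ b → g a ≡ u → g b ≡ u → g c ≡ u → 3 ≤ fibre u Y
  fibre-≥₃ u Y pa pb pc b≢a c≢a c≢b ea eb ec =
    ≤-trans (≤-reflexive (cong₂ _+_ (𝟙-hit ea) (cong₂ _+_ (𝟙-hit eb) (𝟙-hit ec))))
            (∑-≥₃ _ Y pa pb pc b≢a c≢a c≢b)

  fibre-two : (u : B) (Y : List C) → Unique Y → 2 ≤ fibre u Y →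
              Σ C λ a → Σ C λ b → a ∈ Y × b ∈ Y × a ≢ b × g a ≡ u × g b ≡ u
  fibre-two u (y ∷ Y) (y∉ ∷ uY) h with u ≟ g y
  ... | yes e = let (b , pb , eb) = member Y (≤-pred h) in
                y , b , here refl , there pb , (λ y≡b → All¬⇒¬Any y∉ (subst (_∈ Y) (sym y≡b) pb)) , sym e , eb
    where
    member : (Y : List C) → 1 ≤ fibre u Y → Σ C λ b → b ∈ Y × g b ≡ u
    member (z ∷ Z) h with u ≟ g z
    ... | yes e = z , here refl , sym e
    ... | no _  = let (b , pb , eb) = member Z h in b , there pb , eb
  ... | no _ = let (a , b , pa , pb , a≢b , ea , eb) = fibre-two u Y uY h in
               a , b , there pa , there pb , a≢b , ea , eb

module _ {A : Set} where

  length-++-≡ : (a b c d : List A) → a ++ b ≡ c ++ d → length a + length b ≡ length c + length d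
  length-++-≡ a b c d e = trans (sym (length-++ a)) (trans (cong length e) (length-++ c))

  suffix-split : (a b c d : List A) → a ++ b ≡ c ++ d → length d ≤ length b → ∃ λ e → b ≡ e ++ d
  suffix-split []      b c       d e le = c , e
  suffix-split (x ∷ a) b []      d e le = ⊥-elim (<⇒≱ (≤-<-trans le b<d) ≤-refl)
    where
    b<d : length b < length d
    b<d rewrite sym e | length-++ a {b} = s≤s (m≤n+m _ _)
  suffix-split (x ∷ a) b (y ∷ c) d e le = suffix-split a b c d (∷-injectiveʳ e) le

  prefix-split : (a b c d : List A) → a ++ b ≡ c ++ d → length a ≤ length c → ∃ λ e → c ≡ a ++ e
  prefix-split []      b c       d e le       = c , refl
  prefix-split (x ∷ a) b (y ∷ c) d e (s≤s le) with prefix-split a b c d (∷-injectiveʳ e) le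
  ... | t , c≡a++t = t , cong₂ _∷_ (sym (proj₁ (∷-injective e))) c≡a++t

  suffix-unique : (a b c d : List A) → a ++ b ≡ c ++ d → length b ≡ length d → b ≡ d
  suffix-unique a b c d e l with suffix-split a b c d e (≤-reflexive (sym l))
  ... | []    , b≡d   = b≡d
  ... | x ∷ t , b≡x∷t = ⊥-elim (<⇒≢ d<b (sym l))
    where
    d<b : length d < length b
    d<b rewrite b≡x∷t | length-++ t {d} = s≤s (m≤n+m _ _)

  prefix-unique : (a b c d : List A) → a ++ b ≡ c ++ d → length a ≡ length c → a ≡ c
  prefix-unique a b c d e l with prefix-split a b c d e (≤-reflexive l)
  ... | []    , c≡a++[] = trans (sym (++-identityʳ a)) (sym c≡a++[])
  ... | x ∷ t , c≡a++t  = ⊥-elim (<⇒≢ a<c l)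
    where
    a<c : length a < length c
    a<c rewrite c≡a++t | length-++ a {x ∷ t} = ≤-trans (s≤s (m≤m+n _ _)) (≤-reflexive (sym (+-suc _ _)))

  split-last : (xs : List A) (m : ℕ) → length xs ≡ suc m →
           Σ (List A) λ ys → Σ A λ x → xs ≡ ys ++ [ x ] × length ys ≡ m
  split-last (x ∷ [])     zero    _ = [] , x , refl , refl
  split-last (x ∷ y ∷ xs) (suc m) l with split-last (y ∷ xs) m (suc-injective l)
  ... | ys , z , e , l' = x ∷ ys , z , cong (x ∷_) e , cong suc l'

  take-++ : (u v : List A) → take (length u) (u ++ v) ≡ u
  take-++ []      v = refl
  take-++ (x ∷ u) v = cong (x ∷_) (take-++ u v)

  drop-++ : (u v : List A) → drop (length u) (u ++ v) ≡ v
  drop-++ []      v = refl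
  drop-++ (x ∷ u) v = drop-++ u v

  length-snoc : (u : List A) (x : A) → length (u ++ [ x ]) ≡ suc (length u)
  length-snoc u x = trans (length-++ u) (+-comm (length u) 1)

module _ {A : Set} where

  Factor-trans : {u x v : List A} → Factor u x → Factor x v → Factor u v
  Factor-trans {u} (p , s , refl) (p' , s' , refl) =
    p' ++ p , s ++ s' ,
    trans (cong (p' ++_) (trans (++-assoc p (u ++ s) s') (cong (p ++_) (++-assoc u s s'))))
          (sym (++-assoc p' p (u ++ s ++ s')))

  Factor-length : {u v : List A} → Factor u v → length u ≤ length v
  Factor-length {u} (p , s , refl) rewrite length-++ p {u ++ s} | length-++ u {s} =
    ≤-trans (m≤m+n (length u) (length s)) (m≤n+m _ (length p))

  prefix-Factor : (u : List A) (x : A) {v : List A} → Factor (u ++ [ x ]) v → Factor u v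
  prefix-Factor u x = Factor-trans ([] , [ x ] , refl)

  suffix-Factor : (x : A) (u : List A) {v : List A} → Factor (x ∷ u) v → Factor u v
  suffix-Factor x u = Factor-trans ([ x ] , [] , cong (x ∷_) (sym (++-identityʳ u)))

-- Enumerating the factors of a given length, and searching for occurrences

module FactorSets {A : Set} (_≟_ : DecidableEquality A) where

  _≟ₗ_ : DecidableEquality (List A)
  _≟ₗ_ = ≡-dec _≟_

  window : ℕ → List A → List (List A)
  window m xs with m ≤? length xs
  ... | yes _ = take m xs ∷ []
  ... | no _  = []

  windows : ℕ → List A → List (List A)
  windows m []       = window m []
  windows m (x ∷ xs) = window m (x ∷ xs) ++ windows m xs

  window-sound : ∀ m xs u → u ∈ window m xs → length u ≡ m × Factor u xs
  window-sound m xs u p with m ≤? length xs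
  window-sound m xs u (here refl) | yes m≤ =
    trans (length-take m xs) (m≤n⇒m⊓n≡m m≤) , [] , drop m xs , sym (take++drop≡id m xs)

  windows-sound : ∀ m xs u → u ∈ windows m xs → length u ≡ m × Factor u xs
  windows-sound m []       u p = window-sound m [] u p
  windows-sound m (x ∷ xs) u p with ∈-++⁻ (window m (x ∷ xs)) p
  ... | inj₁ q = window-sound m (x ∷ xs) u q
  ... | inj₂ q with windows-sound m xs u q
  ... | l , a , b , e = l , x ∷ a , b , cong (x ∷_) e

  window-complete : ∀ u s → u ∈ window (length u) (u ++ s)
  window-complete u s with length u ≤? length (u ++ s)
  ... | yes _ = here (sym (take-++ u s))
  ... | no ≰ = ⊥-elim (≰ (subst (length u ≤_) (sym (length-++ u)) (m≤m+n _ _)))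

  window-⊆-windows : ∀ m xs {u} → u ∈ window m xs → u ∈ windows m xs
  window-⊆-windows m []       p = p
  window-⊆-windows m (x ∷ xs) p = ∈-++⁺ˡ p

  windows-complete : ∀ u v → Factor u v → u ∈ windows (length u) v
  windows-complete u v ([] , s , refl) = window-⊆-windows (length u) (u ++ s) (window-complete u s)
  windows-complete u v (x ∷ p , s , refl) =
    ∈-++⁺ʳ (window (length u) (x ∷ p ++ u ++ s)) (windows-complete u (p ++ u ++ s) (p , s , refl))

  factors : List A → ℕ → List (List A)
  factors v m = deduplicate _≟ₗ_ (windows m v)

  complexity : List A → ℕ → ℕ
  complexity v m = length (factors v m)

  factors-unique : ∀ v m → Unique (factors v m)
  factors-unique v m = deduplicate-! _≟ₗ_ (windows m v)

  factors-sound : ∀ v m u → u ∈ factors v m → length u ≡ m × Factor u v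
  factors-sound v m u p = windows-sound m v u (∈-deduplicate⁻ _≟ₗ_ (windows m v) p)

  factors-complete : ∀ v u m → length u ≡ m → Factor u v → u ∈ factors v m
  factors-complete v u m refl fu = ∈-deduplicate⁺ _≟ₗ_ (windows-complete u v fu)

  isPrefix? : (u v : List A) → Dec (∃ λ s → v ≡ u ++ s)
  isPrefix? []      v       = yes (v , refl)
  isPrefix? (x ∷ u) []      = no λ { (s , ()) }
  isPrefix? (x ∷ u) (y ∷ v) with x ≟ y | isPrefix? u v
  ... | yes refl | yes (s , e) = yes (s , cong (x ∷_) e)
  ... | yes refl | no ¬pre     = no λ { (s , e) → ¬pre (s , ∷-injectiveʳ e) }
  ... | no x≢y   | _           = no λ { (s , e) → x≢y (sym (proj₁ (∷-injective e))) }

  occurrence? : (u v : List A) (P : ℕ → Set) → (∀ k → Dec (P k)) →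
                Dec (∃ λ p → ∃ λ s → v ≡ p ++ u ++ s × P (length p))
  occurrence? u [] P P? with isPrefix? u [] ×-dec P? 0
  ... | yes ((s , e) , p0) = yes ([] , s , e , p0)
  ... | no ¬here = no λ { ([] , s , e , p0) → ¬here ((s , e) , p0) ; (_ ∷ _ , s , () , _) }
  occurrence? u (y ∷ v) P P? with isPrefix? u (y ∷ v) ×-dec P? 0
                                | occurrence? u v (λ k → P (suc k)) (λ k → P? (suc k))
  ... | yes ((s , e) , p0) | _                      = yes ([] , s , e , p0)
  ... | no _               | yes (p , s , e , Pp)   = yes (y ∷ p , s , cong (y ∷_) e , Pp)
  ... | no ¬here           | no ¬later              =
    no λ { ([] , s , e , p0)      → ¬here ((s , e) , p0)
         ; (z ∷ p , s , e , Pp)   → ¬later (p , s , ∷-injectiveʳ e , Pp) }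

  another-occurrence : (u v p s : List A) → v ≡ p ++ u ++ s → ¬ OccursOnce u v →
                       ∃ λ p' → ∃ λ s' → v ≡ p' ++ u ++ s' × length p' ≢ length p
  another-occurrence u v p s e notOnce
    with occurrence? u v (λ k → k ≢ length p) (λ k → ¬? (k Data.Nat.≟ length p))
  ... | yes occ = occ
  ... | no ¬occ = ⊥-elim (notOnce (p , s , e , samePosition))
    where
    samePosition : ∀ p' s' → v ≡ p' ++ u ++ s' → length p' ≡ length p
    samePosition p' s' e' with length p' Data.Nat.≟ length p
    ... | yes same = same
    ... | no other = ⊥-elim (¬occ (p' , s' , e' , other))

uniqueSuffix-extend : {A : Set} (v : List A) (k m : ℕ) → UniqueSuffixOfLength v k →
                      k ≤ m → m ≤ length v → UniqueSuffixOfLength v m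
uniqueSuffix-extend {A} v k m (u , refl , (t , v≡t++u) , (p₀ , _ , _ , once)) k≤m m≤n =
  σ , |σ| , (τ , sym (take++drop≡id (length v ∸ m) v)) ,
  (τ , [] , v≡τ++σ++[] , λ p' s' e' → +-cancelʳ-≡ _ _ _ (positions p' s' e'))
  where
  τ σ : List A
  τ = take (length v ∸ m) v
  σ = drop (length v ∸ m) v
  |σ| : length σ ≡ m
  |σ| = trans (length-drop (length v ∸ m) v) (m∸[m∸n]≡n m≤n)
  v≡τ++σ++[] : v ≡ τ ++ σ ++ []
  v≡τ++σ++[] = trans (sym (take++drop≡id (length v ∸ m) v)) (cong (τ ++_) (sym (++-identityʳ σ)))
  -- σ = e ++ u, so an occurrence of σ at p' yields an occurrence of u at p' ++ e.
  σ-split : ∃ λ e → σ ≡ e ++ u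
  σ-split = suffix-split τ σ t u (trans (take++drop≡id (length v ∸ m) v) v≡t++u)
                         (subst (length u ≤_) (sym |σ|) k≤m)
  e : List A
  e = proj₁ σ-split
  u-at : ∀ p' s' → v ≡ p' ++ σ ++ s' → v ≡ (p' ++ e) ++ u ++ s'
  u-at p' s' e' = trans e' (trans (cong (λ z → p' ++ z ++ s') (proj₂ σ-split))
                  (trans (cong (p' ++_) (++-assoc e u s')) (sym (++-assoc p' e (u ++ s')))))
  positions : ∀ p' s' → v ≡ p' ++ σ ++ s' → length p' + length e ≡ length τ + length e
  positions p' s' e' = begin
    length p' + length e  ≡⟨ length-++ p' ⟨
    length (p' ++ e)      ≡⟨ once (p' ++ e) s' (u-at p' s' e') ⟩
    length p₀             ≡⟨ once (τ ++ e) [] (u-at τ [] v≡τ++σ++[]) ⟨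
    length (τ ++ e)       ≡⟨ length-++ τ ⟩
    length τ + length e   ∎
    where open ≡-Reasoning

-- For each length m,
-- complexity v (m + 1) - complexity v m = excess m - deadEnds m, where
-- excess m counts the surplus right extensions (nonzero exactly when v has
-- a right special factor of length m) and deadEnds m counts factors of
-- length m with no right extension (this is 1 if m ≥ K_v and 0 otherwise).
module RightExtensions {A : Set} (_≟_ : DecidableEquality A) (v : List A) where
  open FactorSets _≟_

  private
    module F (m : ℕ) = Fibres _≟ₗ_ (take m)

  extensions : ℕ → List A → ℕ
  extensions m u = F.fibre m u (factors v (suc m))

  excess deadEnds : ℕ → ℕ
  excess   m = ∑ (λ u → extensions m u ∸ 1) (factors v m)
  deadEnds m = ∑ (λ u → 1 ∸ extensions m u) (factors v m)

  last-letter : ∀ m y → y ∈ factors v (suc m) → Σ A λ x → y ≡ take m y ++ [ x ]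
  last-letter m y y∈ with split-last y m (proj₁ (factors-sound v (suc m) y y∈))
  ... | ys , x , refl , refl = x , cong (_++ [ x ]) (sym (take-++ ys [ x ]))

  take-factor : ∀ m y → y ∈ factors v (suc m) → take m y ∈ factors v m
  take-factor m y y∈ with factors-sound v (suc m) y y∈ | last-letter m y y∈
  ... | l , fy | x , y≡ = factors-complete v (take m y) m |take|
                            (prefix-Factor (take m y) x (subst (λ z → Factor z v) y≡ fy))
    where
    |take| : length (take m y) ≡ m
    |take| = trans (length-take m y) (m≤n⇒m⊓n≡m (subst (m ≤_) (sym l) (n≤1+n m)))

  balance : ∀ m → complexity v (suc m) + deadEnds m ≡ complexity v m + excess m
  balance m = begin
    complexity v (suc m) + deadEnds m
      ≡⟨ cong (_+ deadEnds m) (F.∑-fibre m (factors v m) (factors v (suc m))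
                                  (factors-unique v m) (take-factor m)) ⟨
    ∑ (extensions m) (factors v m) + deadEnds m
      ≡⟨ ∑-excess-deficit (extensions m) (factors v m) ⟩
    excess m + complexity v m
      ≡⟨ +-comm (excess m) _ ⟩
    complexity v m + excess m ∎
    where open ≡-Reasoning

  take-snoc : ∀ m (u : List A) (x : A) → length u ≡ m → take m (u ++ [ x ]) ≡ u
  take-snoc m u x refl = take-++ u [ x ]

  snoc-factor : ∀ m (u : List A) (x : A) → length u ≡ m → Factor (u ++ [ x ]) v →
                u ++ [ x ] ∈ factors v (suc m)
  snoc-factor m u x refl = factors-complete v (u ++ [ x ]) (suc m) (length-snoc u x)

  extended : ∀ m u p x s → length u ≡ m → v ≡ p ++ u ++ x ∷ s → 1 ≤ extensions m u
  extended m u p x s l e =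
    F.fibre-≥₁ m u (factors v (suc m)) (snoc-factor m u x l (p , s , e′)) (take-snoc m u x l)
    where
    e′ : v ≡ p ++ (u ++ [ x ]) ++ s
    e′ = trans e (cong (p ++_) (sym (++-assoc u [ x ] s)))

  dead-end⇒suffix : ∀ m u p s → length u ≡ m → v ≡ p ++ u ++ s → extensions m u ≡ 0 → s ≡ []
  dead-end⇒suffix m u p []      l e z = refl
  dead-end⇒suffix m u p (x ∷ s) l e z = ⊥-elim (<⇒≢ (extended m u p x s l e) (sym z))

  deadEnds-below : ∀ K m → IsK v K → m < K → deadEnds m ≡ 0
  deadEnds-below K m (_ , shorter-not-unique) m<K = ∑-zero _ (factors v m) extendable
    where
    extendable : ∀ u → u ∈ factors v m → 1 ∸ extensions m u ≡ 0
    extendable u u∈ with factors-sound v m u u∈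
    ... | l , p , s , e = m≤n⇒m∸n≡0 (n≢0⇒n>0 no-dead-end)
      where
      no-dead-end : extensions m u ≢ 0
      no-dead-end z with dead-end⇒suffix m u p s l e z
      ... | refl with another-occurrence u v p [] e
                        (λ once → shorter-not-unique m m<K
                          (u , l , (p , trans e (cong (p ++_) (++-identityʳ u))) , once))
      ... | p' , s' , e' , |p'|≢|p| with dead-end⇒suffix m u p' s' l e' z
      ... | refl = |p'|≢|p| (+-cancelʳ-≡ _ _ _ (length-++-≡ p' (u ++ []) p (u ++ []) (trans (sym e') e)))

  unique-suffix-dead-end : ∀ m σ t → v ≡ t ++ σ ++ [] → OccursOnce σ v → extensions m σ ≡ 0
  unique-suffix-dead-end m σ t v≡tσ (_ , _ , _ , once) = ∑-zero _ (factors v (suc m)) not-σx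
    where
    not-σx : ∀ y → y ∈ factors v (suc m) → 𝟙 (σ ≟ₗ take m y) ≡ 0
    not-σx y y∈ with σ ≟ₗ take m y
    ... | no _ = refl
    ... | yes σ≡ with last-letter m y y∈ | factors-sound v (suc m) y y∈
    ... | x , y≡ | _ , a , b , e = ⊥-elim (x∷b≢[] tails-agree)
      where
      v≡aσxb : v ≡ a ++ σ ++ x ∷ b
      v≡aσxb = trans e (trans (cong (λ z → a ++ z ++ b) (trans y≡ (cong (_++ [ x ]) (sym σ≡))))
                              (cong (a ++_) (++-assoc σ [ x ] b)))
      a≡t : a ≡ t
      a≡t = prefix-unique a (σ ++ x ∷ b) t (σ ++ []) (trans (sym v≡aσxb) v≡tσ)
              (trans (once a (x ∷ b) v≡aσxb) (sym (once t [] v≡tσ)))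
      tails-agree : x ∷ b ≡ []
      tails-agree = ++-cancelˡ σ _ _ (++-cancelˡ a _ _ (trans (sym v≡aσxb) (trans v≡tσ (cong (_++ σ ++ []) (sym a≡t)))))
      x∷b≢[] : x ∷ b ≢ []
      x∷b≢[] ()

  deadEnds-above : ∀ K m → IsK v K → K ≤ m → m ≤ length v → deadEnds m ≡ 1
  deadEnds-above K m (uniqK , _) K≤m m≤n
    with uniqueSuffix-extend v K m uniqK K≤m m≤n
  ... | σ , |σ| , (t , v≡t++σ) , σ-once =
    trans (∑-cong _ _ (factors v m) dead-end-iff-σ)
          (∑-𝟙-unique _≟ₗ_ σ (factors v m) (factors-unique v m) σ∈)
    where
    v≡t++σ++[] : v ≡ t ++ σ ++ []
    v≡t++σ++[] = trans v≡t++σ (cong (t ++_) (sym (++-identityʳ σ)))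
    σ∈ : σ ∈ factors v m
    σ∈ = factors-complete v σ m |σ| (t , [] , v≡t++σ++[])
    dead-end-iff-σ : ∀ u → u ∈ factors v m → 1 ∸ extensions m u ≡ 𝟙 (u ≟ₗ σ)
    dead-end-iff-σ u u∈ with u ≟ₗ σ
    ... | yes refl = cong (1 ∸_) (unique-suffix-dead-end m σ t v≡t++σ++[] σ-once)
    ... | no u≢σ with factors-sound v m u u∈
    ... | l , p , s , e = m≤n⇒m∸n≡0 (n≢0⇒n>0 no-dead-end)
      where
      no-dead-end : extensions m u ≢ 0
      no-dead-end z with dead-end⇒suffix m u p s l e z
      ... | refl = u≢σ (suffix-unique p u t σ (trans (sym (trans e (cong (p ++_) (++-identityʳ u)))) v≡t++σ)
                                       (trans l (sym |σ|)))

  deadEnds-≡ : ∀ K m → IsK v K → m ≤ length v → deadEnds m ≡ 𝟙 (K ≤? m)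
  deadEnds-≡ K m isK m≤n with K ≤? m
  ... | yes K≤m = deadEnds-above K m isK K≤m m≤n
  ... | no K≰m  = deadEnds-below K m isK (≰⇒> K≰m)

  snoc-≢ : (u : List A) {x y : A} → x ≢ y → u ++ [ x ] ≢ u ++ [ y ]
  snoc-≢ u x≢y e = x≢y (proj₂ (∷ʳ-injective u u e))

  RightSpecial⇒factor : ∀ m u → length u ≡ m → RightSpecial u v → u ∈ factors v m
  RightSpecial⇒factor m u l (x , _ , _ , fx , _) = factors-complete v u m l (prefix-Factor u x fx)

  RightSpecial⇒extensions : ∀ m u → length u ≡ m → RightSpecial u v → 2 ≤ extensions m u
  RightSpecial⇒extensions m u l (x , y , x≢y , fx , fy) =
    F.fibre-≥₂ m u (factors v (suc m)) (snoc-factor m u x l fx) (snoc-factor m u y l fy)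
               (snoc-≢ u (λ e → x≢y (sym e))) (take-snoc m u x l) (take-snoc m u y l)

  excess-pos : ∀ m → HasRSOfLength v m → 1 ≤ excess m
  excess-pos m (u , l , rs) = ≤-trans (∸-monoˡ-≤ 1 (RightSpecial⇒extensions m u l rs))
                                      (∑-≥₁ _ (factors v m) (RightSpecial⇒factor m u l rs))

  excess-zero : ∀ m → ¬ HasRSOfLength v m → excess m ≡ 0
  excess-zero m noRS = ∑-zero _ (factors v m) at-most-one
    where
    at-most-one : ∀ u → u ∈ factors v m → extensions m u ∸ 1 ≡ 0
    at-most-one u u∈ with 2 ≤? extensions m u
    ... | no  ≱2 = m≤n⇒m∸n≡0 (≤-pred (≰⇒> ≱2))
    ... | yes ≥2 with F.fibre-two m u (factors v (suc m)) (factors-unique v (suc m)) ≥2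
    ... | a , b , a∈ , b∈ , a≢b , ta , tb with last-letter m a a∈ | last-letter m b b∈
    ... | x , a≡ | y , b≡ = ⊥-elim (noRS (u , proj₁ (factors-sound v m u u∈) , x , y , x≢y ,
                                        extension-factor a a∈ ta a≡ , extension-factor b b∈ tb b≡))
      where
      x≢y : x ≢ y
      x≢y refl = a≢b (trans a≡ (trans (cong (_++ [ x ]) (trans ta (sym tb))) (sym b≡)))
      extension-factor : ∀ c {z} → c ∈ factors v (suc m) → take m c ≡ u → c ≡ take m c ++ [ z ] →
                         Factor (u ++ [ z ]) v
      extension-factor c {z} c∈ tc c≡ =
        subst (λ w → Factor w v) (trans c≡ (cong (_++ [ z ]) tc)) (proj₂ (factors-sound v (suc m) c c∈))

  excess≤1⇒unique : ∀ m u₁ u₂ → excess m ≤ 1 → length u₁ ≡ m → length u₂ ≡ m →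
                    RightSpecial u₁ v → RightSpecial u₂ v → u₁ ≡ u₂
  excess≤1⇒unique m u₁ u₂ ≤1 l₁ l₂ rs₁ rs₂ with u₁ ≟ₗ u₂
  ... | yes u₁≡u₂ = u₁≡u₂
  ... | no  u₁≢u₂ = ⊥-elim (<⇒≱ (s≤s ≤1) (≤-trans
          (+-mono-≤ (∸-monoˡ-≤ 1 (RightSpecial⇒extensions m u₁ l₁ rs₁))
                    (∸-monoˡ-≤ 1 (RightSpecial⇒extensions m u₂ l₂ rs₂)))
          (∑-≥₂ _ (factors v m) (RightSpecial⇒factor m u₁ l₁ rs₁) (RightSpecial⇒factor m u₂ l₂ rs₂)
                (λ e → u₁≢u₂ (sym e)))))

  excess≤1⇒no-three : ∀ m u (a b c : A) → excess m ≤ 1 → length u ≡ m → b ≢ a → c ≢ a → c ≢ b →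
                      Factor (u ++ [ a ]) v → Factor (u ++ [ b ]) v → Factor (u ++ [ c ]) v → ⊥
  excess≤1⇒no-three m u a b c ≤1 l b≢a c≢a c≢b fa fb fc =
    <⇒≱ (s≤s ≤1) (≤-trans (∸-monoˡ-≤ 1 three-extensions)
                          (∑-≥₁ _ (factors v m) (factors-complete v u m l (prefix-Factor u a fa))))
    where
    three-extensions : 3 ≤ extensions m u
    three-extensions = F.fibre-≥₃ m u (factors v (suc m))
      (snoc-factor m u a l fa) (snoc-factor m u b l fb) (snoc-factor m u c l fc)
      (snoc-≢ u b≢a) (snoc-≢ u c≢a) (snoc-≢ u c≢b)
      (take-snoc m u a l) (take-snoc m u b l) (take-snoc m u c l)

-- Reversal exchanges left and right: the left-hand notions (L_v, H_v) of v
-- are the right-hand notions (R, K) of its reversal, which has the same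
-- factor complexity.

module _ {A : Set} where

  reverse-++₃ : (p u s : List A) → reverse (p ++ u ++ s) ≡ reverse s ++ reverse u ++ reverse p
  reverse-++₃ p u s = trans (reverse-++ p (u ++ s))
                            (trans (cong (_++ reverse p) (reverse-++ u s)) (++-assoc (reverse s) (reverse u) (reverse p)))

  reverse-occurrence : {u v : List A} (p s : List A) → reverse v ≡ p ++ reverse u ++ s →
                       v ≡ reverse s ++ u ++ reverse p
  reverse-occurrence {u} {v} p s e =
    trans (sym (reverse-involutive v))
          (trans (cong reverse e) (trans (reverse-++₃ p (reverse u) s)
                                         (cong (λ z → reverse s ++ z ++ reverse p) (reverse-involutive u))))

  Factor-reverse : {u v : List A} → Factor u v → Factor (reverse u) (reverse v)
  Factor-reverse {u} (p , s , refl) = reverse s , reverse p , reverse-++₃ p u s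

  Factor-reverse⁻ : {u v : List A} → Factor u (reverse v) → Factor (reverse u) v
  Factor-reverse⁻ {u} {v} f = subst (Factor (reverse u)) (reverse-involutive v) (Factor-reverse f)

  OccursOnce-reverse : {u v : List A} → OccursOnce u v → OccursOnce (reverse u) (reverse v)
  OccursOnce-reverse {u} {v} (p , s , e , once) =
    reverse s , reverse p , trans (cong reverse e) (reverse-++₃ p u s) , same-position
    where
    length₃ : ∀ {w} a b c → w ≡ a ++ b ++ c → length w ≡ length a + (length b + length c)
    length₃ a b c refl = trans (length-++ a) (cong (length a +_) (length-++ b))
    same-position : ∀ p' s' → reverse v ≡ p' ++ reverse u ++ s' → length p' ≡ length (reverse s)
    same-position p' s' e' = +-cancelʳ-≡ _ _ _ (begin
      length p' + (length u + length p)
        ≡⟨ cong (λ k → length p' + (k + length p)) (sym (length-reverse u)) ⟩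
      length p' + (length (reverse u) + length p)
        ≡⟨ cong (λ k → length p' + (length (reverse u) + k))
                (trans (sym (once (reverse s') (reverse p') (reverse-occurrence {u} p' s' e'))) (length-reverse s')) ⟩
      length p' + (length (reverse u) + length s')
        ≡⟨ trans (sym (length₃ p' (reverse u) s' e')) (length-reverse v) ⟩
      length v
        ≡⟨ length₃ p u s e ⟩
      length p + (length u + length s)
        ≡⟨ rearrange (length p) (length u) (length s) ⟩
      length s + (length u + length p)
        ≡⟨ cong (_+ (length u + length p)) (sym (length-reverse s)) ⟩
      length (reverse s) + (length u + length p) ∎)
      where
      open ≡-Reasoning
      rearrange : ∀ a b c → a + (b + c) ≡ c + (b + a)
      rearrange = solve-∀

  OccursOnce-reverse⁻ : {u v : List A} → OccursOnce u (reverse v) → OccursOnce (reverse u) v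
  OccursOnce-reverse⁻ {u} {v} o = subst (OccursOnce (reverse u)) (reverse-involutive v) (OccursOnce-reverse o)

  LeftSpecial-reverse : {u v : List A} → LeftSpecial u v → RightSpecial (reverse u) (reverse v)
  LeftSpecial-reverse {u} {v} (x , y , x≢y , fx , fy) =
    x , y , x≢y , subst (λ z → Factor z (reverse v)) (reverse-++ [ x ] u) (Factor-reverse fx)
                , subst (λ z → Factor z (reverse v)) (reverse-++ [ y ] u) (Factor-reverse fy)

  RightSpecial-reverse⁻ : {u v : List A} → RightSpecial u (reverse v) → LeftSpecial (reverse u) v
  RightSpecial-reverse⁻ {u} {v} (x , y , x≢y , fx , fy) =
    x , y , x≢y , subst (λ z → Factor z v) (reverse-++ u [ x ]) (Factor-reverse⁻ fx)
                , subst (λ z → Factor z v) (reverse-++ u [ y ]) (Factor-reverse⁻ fy)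

  IsL⇒IsR-reverse : {v : List A} {L : ℕ} → IsL v L → IsR (reverse v) L
  IsL⇒IsR-reverse (1≤L , noLS , allLS) =
    1≤L ,
    (λ { (u , l , rs) → noLS (reverse u , trans (length-reverse u) l , RightSpecial-reverse⁻ rs) }) ,
    (λ l' 1≤l' l'<L → let (u , l , ls) = allLS l' 1≤l' l'<L in
                      reverse u , trans (length-reverse u) l , LeftSpecial-reverse ls)

  IsH⇒IsK-reverse : {v : List A} {H : ℕ} → IsH v H → IsK (reverse v) H
  IsH⇒IsK-reverse {v} ((u , l , (t , v≡u++t) , once) , shorter) =
    (reverse u , trans (length-reverse u) l , (reverse t , trans (cong reverse v≡u++t) (reverse-++ u t)) ,
     OccursOnce-reverse once) ,
    λ { h' h'<H (u' , l' , (t' , rv≡t'++u') , once') →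
          shorter h' h'<H (reverse u' , trans (length-reverse u') l' ,
                           (reverse t' , trans (sym (reverse-involutive v))
                                               (trans (cong reverse rv≡t'++u') (reverse-++ t' u'))) ,
                           OccursOnce-reverse⁻ once') }

module _ {A : Set} (_≟_ : DecidableEquality A) where
  open FactorSets _≟_

  complexity-reverse-≤ : ∀ v m → complexity (reverse v) m ≤ complexity v m
  complexity-reverse-≤ v m =
    ≤-trans (unique-⊆-length (factors (reverse v) m) (map reverse (factors v m))
                             (factors-unique (reverse v) m) reversed-factor)
            (≤-reflexive (length-map reverse (factors v m)))
    where
    reversed-factor : ∀ u → u ∈ factors (reverse v) m → u ∈ map reverse (factors v m)
    reversed-factor u u∈ with factors-sound (reverse v) m u u∈
    ... | l , fu = subst (_∈ map reverse (factors v m)) (reverse-involutive u)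
                     (∈-map⁺ reverse (factors-complete v (reverse u) m (trans (length-reverse u) l)
                                        (Factor-reverse⁻ fu)))

  complexity-reverse : ∀ v m → complexity (reverse v) m ≡ complexity v m
  complexity-reverse v m = ≤-antisym (complexity-reverse-≤ v m)
    (subst (λ w → complexity w m ≤ complexity (reverse v) m) (reverse-involutive v)
           (complexity-reverse-≤ (reverse v) m))

module _ {A : Set} (_≟_ : DecidableEquality A) (v : List A) where
  open FactorSets _≟_

  complexity-beyond : complexity v (suc (length v)) ≡ 0
  complexity-beyond with factors v (suc (length v)) in e
  ... | []    = refl
  ... | u ∷ _ with factors-sound v (suc (length v)) u (subst (u ∈_) (sym e) (here refl))
  ... | l , fu = ⊥-elim (<⇒≱ (≤-reflexive (sym l)) (Factor-length fu))

  complexity-one : complexity v 1 ≡ alphSize _≟_ v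
  complexity-one =
    ≤-antisym (≤-trans (unique-⊆-length (factors v 1) (map [_] letters) (factors-unique v 1) factor⇒letter)
                       (≤-reflexive (length-map [_] letters)))
              (≤-trans (≤-reflexive (sym (length-map [_] letters)))
                       (unique-⊆-length (map [_] letters) (factors v 1)
                                        (map⁺ [_]-injective (deduplicate-! _≟_ v)) letter⇒factor))
    where
    letters : List A
    letters = deduplicate _≟_ v
    [_]-injective : ∀ {x y : A} → [ x ] ≡ [ y ] → x ≡ y
    [_]-injective refl = refl
    factor⇒letter : ∀ u → u ∈ factors v 1 → u ∈ map [_] letters
    factor⇒letter u u∈ with factors-sound v 1 u u∈
    factor⇒letter (x ∷ []) u∈ | _ , p , s , refl = ∈-map⁺ [_] (∈-deduplicate⁺ _≟_ (∈-++⁺ʳ p (here refl)))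
    letter⇒factor : ∀ u → u ∈ map [_] letters → u ∈ factors v 1
    letter⇒factor u u∈ with ∈-map⁻ [_] u∈
    ... | x , x∈ , refl with ∈-∃++ (∈-deduplicate⁻ _≟_ v x∈)
    ... | p , s , e = factors-complete v [ x ] 1 refl (p , s , e)

-- The empty word occurs at every position, so it never occurs exactly once in a non-empty word.
empty-not-once : {A : Set} (v : List A) → v ≢ [] → ¬ OccursOnce [] v
empty-not-once []      v≢[] _                 = v≢[] refl
empty-not-once (x ∷ w) _    (_ , _ , _ , once) = 0≢1+n (trans (once [] (x ∷ w) refl) (sym (once [ x ] w refl)))

nonempty-length : {A : Set} (v : List A) → v ≢ [] → 1 ≤ length v
nonempty-length []      v≢[] = ⊥-elim (v≢[] refl)
nonempty-length (_ ∷ _) _    = s≤s z≤n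

module _ {A : Set} {v : List A} where

  R≤length : ∀ {R} → IsR v R → 1 ≤ length v → R ≤ length v
  R≤length {R} (_ , _ , shorter) 1≤n with R ≤? length v
  ... | yes R≤n = R≤n
  ... | no  R≰n with shorter (length v) 1≤n (≰⇒> R≰n)
  ... | u , l , x , _ , _ , fx , _ =
    ⊥-elim (<⇒≱ (≤-reflexive (cong suc (sym l)))
                (≤-trans (≤-reflexive (sym (length-snoc u x))) (Factor-length fx)))

  K≤length : ∀ {K} → IsK v K → K ≤ length v
  K≤length ((u , refl , (t , refl) , _) , _) = subst (length u ≤_) (sym (length-++ t)) (m≤n+m _ _)

  1≤K : ∀ {K} → IsK v K → v ≢ [] → 1 ≤ K
  1≤K {zero}  (([] , _ , _ , once) , _) v≢[] = ⊥-elim (empty-not-once v v≢[] once)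
  1≤K {suc K} _ _ = s≤s z≤n

  -- Right special factors are closed under taking suffixes, so none is as long as R_v.
  no-RightSpecial-beyond : ∀ {R} m → IsR v R → R ≤ m → ¬ HasRSOfLength v m
  no-RightSpecial-beyond {R} m (_ , noRS , _) R≤m (u , l , x , y , x≢y , fx , fy) =
    noRS (drop (m ∸ R) u , trans (length-drop (m ∸ R) u) (trans (cong (_∸ (m ∸ R)) l) (m∸[m∸n]≡n R≤m)) ,
          x , y , x≢y , shorten x fx , shorten y fy)
    where
    shorten : ∀ z → Factor (u ++ [ z ]) v → Factor (drop (m ∸ R) u ++ [ z ]) v
    shorten z = Factor-trans (take (m ∸ R) u , [] ,
      trans (cong (_++ [ z ]) (sym (take++drop≡id (m ∸ R) u)))
            (trans (++-assoc (take (m ∸ R) u) _ [ z ]) (cong (take (m ∸ R) u ++_) (sym (++-identityʳ _)))))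

-- Sums over an initial segment 1, …, j of the positive integers

sumTo : (ℕ → ℕ) → ℕ → ℕ
sumTo g zero    = 0
sumTo g (suc j) = sumTo g j + g (suc j)

sumTo-cong : (g h : ℕ → ℕ) → ∀ j → (∀ m → 1 ≤ m → m ≤ j → g m ≡ h m) → sumTo g j ≡ sumTo h j
sumTo-cong g h zero    e = refl
sumTo-cong g h (suc j) e = cong₂ _+_ (sumTo-cong g h j (λ m 1≤m m≤j → e m 1≤m (m≤n⇒m≤1+n m≤j)))
                                     (e (suc j) (s≤s z≤n) ≤-refl)

sumTo-+ : (g h : ℕ → ℕ) → ∀ j → sumTo (λ m → g m + h m) j ≡ sumTo g j + sumTo h j
sumTo-+ g h zero    = refl
sumTo-+ g h (suc j) rewrite sumTo-+ g h j = interchange (sumTo g j) (sumTo h j) (g (suc j)) (h (suc j))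
  where
  interchange : ∀ a b c d → a + b + (c + d) ≡ a + c + (b + d)
  interchange = solve-∀

sumTo-term : (g : ℕ → ℕ) → ∀ j m → 1 ≤ m → m ≤ j → g m ≤ sumTo g j
sumTo-term g zero    m 1≤m m≤0 = ⊥-elim (<⇒≱ 1≤m m≤0)
sumTo-term g (suc j) m 1≤m m≤j with m Data.Nat.≟ suc j
... | yes refl = m≤n+m _ _
... | no  m≢   = ≤-trans (sumTo-term g j m 1≤m (≤-pred (≤∧≢⇒< m≤j m≢))) (m≤m+n _ _)

sumTo-atLeast : ∀ K j → 1 ≤ K → K ≤ suc j → sumTo (λ m → 𝟙 (K ≤? m)) j + K ≡ suc j
sumTo-atLeast K zero    1≤K K≤1 = ≤-antisym K≤1 1≤K
sumTo-atLeast K (suc j) 1≤K K≤  with K ≤? suc j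
... | yes K≤j = trans (shift (sumTo _ j) K) (cong suc (sumTo-atLeast K j 1≤K K≤j))
  where
  shift : ∀ a b → a + 1 + b ≡ suc (a + b)
  shift = solve-∀
... | no  K≰j = trans (cong (_+ K) (trans (+-identityʳ _) (sumTo-none j (≤-trans (n≤1+n _) (≰⇒> K≰j)))))
                      (≤-antisym K≤ (≰⇒> K≰j))
  where
  sumTo-none : ∀ j → j < K → sumTo (λ m → 𝟙 (K ≤? m)) j ≡ 0
  sumTo-none zero    _   = refl
  sumTo-none (suc j) j<K = cong₂ _+_ (sumTo-none j (≤-trans (n≤1+n _) j<K)) (𝟙-no (K ≤? suc j) (<⇒≱ j<K))

sumTo-below : ∀ R j → 1 ≤ R → R ≤ suc j → suc (sumTo (λ m → 𝟙 (m <? R)) j) ≡ R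
sumTo-below R zero    1≤R R≤1 = sym (≤-antisym R≤1 1≤R)
sumTo-below R (suc j) 1≤R R≤  with R ≤? suc j
... | yes R≤j = trans (cong suc (trans (cong (sumTo _ j +_) (𝟙-no (suc j <? R) (≤⇒≯ R≤j))) (+-identityʳ _)))
                      (sumTo-below R j 1≤R R≤j)
... | no  R≰j = trans (cong suc (trans (cong₂ _+_ (sumTo-all j (≤-trans (n≤1+n _) (≰⇒> R≰j)))
                                                   (𝟙-yes (suc j <? R) (≰⇒> R≰j)))
                                       (+-comm j 1)))
                      (≤-antisym (≰⇒> R≰j) R≤)
  where
  sumTo-all : ∀ j → j < R → sumTo (λ m → 𝟙 (m <? R)) j ≡ j
  sumTo-all zero    _   = refl
  sumTo-all (suc j) j<R = trans (cong₂ _+_ (sumTo-all j (≤-trans (n≤1+n _) j<R)) (𝟙-yes (suc j <? R) j<R))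
                                (+-comm j 1)

telescope : (n : ℕ) (f z e : ℕ → ℕ) → (∀ m → 1 ≤ m → m ≤ n → f (suc m) + z m ≡ f m + e m) →
            ∀ j → j ≤ n → f (suc j) + sumTo z j ≡ f 1 + sumTo e j
telescope n f z e step zero    _   = refl
telescope n f z e step (suc j) j<n = begin
  f (suc (suc j)) + (sumTo z j + z (suc j))  ≡⟨ regroup (f (suc (suc j))) (sumTo z j) (z (suc j)) ⟩
  (f (suc (suc j)) + z (suc j)) + sumTo z j  ≡⟨ cong (_+ sumTo z j) (step (suc j) (s≤s z≤n) j<n) ⟩
  (f (suc j) + e (suc j)) + sumTo z j        ≡⟨ swap (f (suc j)) (e (suc j)) (sumTo z j) ⟩
  (f (suc j) + sumTo z j) + e (suc j)        ≡⟨ cong (_+ e (suc j)) (telescope n f z e step j (≤-trans (n≤1+n j) j<n)) ⟩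
  (f 1 + sumTo e j) + e (suc j)              ≡⟨ +-assoc (f 1) _ _ ⟩
  f 1 + (sumTo e j + e (suc j))              ∎
  where
  open ≡-Reasoning
  regroup : ∀ a b c → a + (b + c) ≡ a + c + b
  regroup = solve-∀
  swap : ∀ a b c → a + b + c ≡ a + c + b
  swap = solve-∀

balance-≤ : ∀ {a b i j} → a + i ≡ b + j → j ≤ i → a ≤ b
balance-≤ {a} {b} {i} e j≤i = +-cancelʳ-≤ i a b (≤-trans (≤-reflexive e) (+-monoʳ-≤ b j≤i))

balance-< : ∀ {a b i j} → a + i ≡ b + j → j < i → a < b
balance-< {a} {b} {i} {j} e j<i =
  +-cancelʳ-≤ j (suc a) b (≤-trans (≤-reflexive (sym (+-suc a j))) (≤-trans (+-monoʳ-≤ a j<i) (≤-reflexive e)))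

𝟙-mono : {P Q : Set} (p : Dec P) (q : Dec Q) → (P → Q) → 𝟙 p ≤ 𝟙 q
𝟙-mono (yes P) (yes _) _   = ≤-refl
𝟙-mono (yes P) (no ¬Q) P→Q = ⊥-elim (¬Q (P→Q P))
𝟙-mono (no _)  _       _   = z≤n

𝟙-strict : {P Q : Set} (p : Dec P) (q : Dec Q) → ¬ P → Q → 𝟙 p < 𝟙 q
𝟙-strict p q ¬P Q rewrite 𝟙-no p ¬P | 𝟙-yes q Q = s≤s z≤n

m⊓n+m⊔n≡m+n : ∀ m n → m ⊓ n + (m ⊔ n) ≡ m + n
m⊓n+m⊔n≡m+n m n with m ≤? n
... | yes m≤n = cong₂ _+_ (m≤n⇒m⊓n≡m m≤n) (m≤n⇒m⊔n≡n m≤n)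
... | no  m≰n = trans (cong₂ _+_ (m≥n⇒m⊓n≡n (≰⇒≥ m≰n)) (m≥n⇒m⊔n≡m (≰⇒≥ m≰n))) (+-comm n m)

-- A sequence f (the factor complexity of a word of
-- length n with α letters) satisfies a right balance equation governed by
-- R, K and a left one governed by L, H.  When n + 2 = R + K + α, the right
-- excess is forced to its minimum 1_{m<R}: f increases strictly below
-- min(R, K), is constant up to max(R, K) and decreases strictly afterwards.
-- Comparing with the shape imposed by the left equation pins down
-- min(L, H) and max(L, H), provided min(R, K) ≤ H.
module ComplexityProfile
  (n α R K L H : ℕ) (f excessR excessL : ℕ → ℕ)
  (right-balance : ∀ m → 1 ≤ m → m ≤ n → f (suc m) + 𝟙 (K ≤? m) ≡ f m + excessR m)
  (left-balance  : ∀ m → 1 ≤ m → m ≤ n → f (suc m) + 𝟙 (H ≤? m) ≡ f m + excessL m)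
  (f-one : f 1 ≡ α) (f-beyond : f (suc n) ≡ 0)
  (excessR-pos  : ∀ m → 1 ≤ m → m < R → 1 ≤ excessR m)
  (excessL-pos  : ∀ m → 1 ≤ m → m < L → 1 ≤ excessL m)
  (excessL-zero : ∀ m → L ≤ m → excessL m ≡ 0)
  (1≤R : 1 ≤ R) (1≤K : 1 ≤ K) (1≤L : 1 ≤ L)
  (R≤n : R ≤ n) (K≤n : K ≤ n) (L≤n : L ≤ n) (H≤n : H ≤ n)
  (extremal : n + 2 ≡ R + K + α) where

  excessR-lower : ∀ m → 1 ≤ m → 𝟙 (m <? R) ≤ excessR m
  excessR-lower m 1≤m with m <? R
  ... | yes m<R = excessR-pos m 1≤m m<R
  ... | no  _   = z≤n

  surplus : ℕ → ℕ
  surplus m = excessR m ∸ 𝟙 (m <? R)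

  -- Summing the right balance over m = 1, …, n:  0 + (n + 1 - K) = α + (R - 1) + Σ surplus,
  -- so the extremality hypothesis leaves no room for any surplus.
  no-surplus : sumTo surplus n ≡ 0
  no-surplus = +-cancelʳ-≡ (suc ones + K + α) _ _ (begin
    sumTo surplus n + (suc ones + K + α)   ≡⟨ regroup (sumTo surplus n) ones K α ⟩
    suc (α + (sumTo surplus n + ones) + K) ≡⟨ cong (λ z → suc (z + K)) summed ⟨
    suc (sumTo (λ m → 𝟙 (K ≤? m)) n + K)   ≡⟨ cong suc (sumTo-atLeast K n 1≤K (≤-trans K≤n (n≤1+n n))) ⟩
    2 + n                                  ≡⟨ +-comm 2 n ⟩
    n + 2                                  ≡⟨ extremal ⟩
    R + K + α                              ≡⟨ cong (λ z → z + K + α) (sumTo-below R n 1≤R (≤-trans R≤n (n≤1+n n))) ⟨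
    suc ones + K + α                       ∎)
    where
    open ≡-Reasoning
    ones : ℕ
    ones = sumTo (λ m → 𝟙 (m <? R)) n
    split : sumTo excessR n ≡ sumTo surplus n + ones
    split = trans (sumTo-cong _ _ n (λ m 1≤m _ → sym (m∸n+n≡m (excessR-lower m 1≤m)))) (sumTo-+ surplus _ n)
    summed : sumTo (λ m → 𝟙 (K ≤? m)) n ≡ α + (sumTo surplus n + ones)
    summed = trans (sym (cong (_+ sumTo _ n) f-beyond))
                   (trans (telescope n f _ excessR right-balance n ≤-refl) (cong₂ _+_ f-one split))
    regroup : ∀ a b c d → a + (suc b + c + d) ≡ suc (d + (a + b) + c)
    regroup = solve-∀

  excessR-exact : ∀ m → 1 ≤ m → m ≤ n → excessR m ≡ 𝟙 (m <? R)
  excessR-exact m 1≤m m≤n = ≤-antisym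
    (m∸n≡0⇒m≤n (n≤0⇒n≡0 (subst (surplus m ≤_) no-surplus (sumTo-term surplus n m 1≤m m≤n))))
    (excessR-lower m 1≤m)

  right-step : ∀ m → 1 ≤ m → m ≤ n → f (suc m) + 𝟙 (K ≤? m) ≡ f m + 𝟙 (m <? R)
  right-step m 1≤m m≤n = trans (right-balance m 1≤m m≤n) (cong (f m +_) (excessR-exact m 1≤m m≤n))

  right-increasing : ∀ m → 1 ≤ m → m ≤ n → m < K → m < R → f m < f (suc m)
  right-increasing m 1≤m m≤n m<K m<R =
    balance-< (sym (right-step m 1≤m m≤n)) (𝟙-strict (K ≤? m) (m <? R) (<⇒≱ m<K) m<R)

  right-nondecreasing : ∀ m → 1 ≤ m → m ≤ n → m < K ⊎ m < R → f m ≤ f (suc m)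
  right-nondecreasing m 1≤m m≤n below = balance-≤ (sym (right-step m 1≤m m≤n)) (𝟙-mono (K ≤? m) (m <? R) K≤m⇒m<R)
    where
    K≤m⇒m<R : K ≤ m → m < R
    K≤m⇒m<R K≤m = [ (λ m<K → ⊥-elim (<⇒≱ m<K K≤m)) , (λ m<R → m<R) ]′ below

  right-decreasing : ∀ m → 1 ≤ m → m ≤ n → K ≤ m → R ≤ m → f (suc m) < f m
  right-decreasing m 1≤m m≤n K≤m R≤m =
    balance-< (right-step m 1≤m m≤n) (𝟙-strict (m <? R) (K ≤? m) (≤⇒≯ R≤m) K≤m)

  right-nonincreasing : ∀ m → 1 ≤ m → m ≤ n → K ≤ m ⊎ R ≤ m → f (suc m) ≤ f m
  right-nonincreasing m 1≤m m≤n above = balance-≤ (right-step m 1≤m m≤n) (𝟙-mono (m <? R) (K ≤? m) m<R⇒K≤m)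
    where
    m<R⇒K≤m : m < R → K ≤ m
    m<R⇒K≤m m<R = [ (λ K≤m → K≤m) , (λ R≤m → ⊥-elim (<⇒≱ m<R R≤m)) ]′ above

  left-increasing : ∀ m → 1 ≤ m → m ≤ n → m < H → m < L → f m < f (suc m)
  left-increasing m 1≤m m≤n m<H m<L =
    balance-< (sym (left-balance m 1≤m m≤n))
              (≤-trans (s≤s (≤-reflexive (𝟙-no (H ≤? m) (<⇒≱ m<H)))) (excessL-pos m 1≤m m<L))

  left-nondecreasing : ∀ m → 1 ≤ m → m ≤ n → m < H ⊎ m < L → f m ≤ f (suc m)
  left-nondecreasing m 1≤m m≤n (inj₁ m<H) =
    balance-≤ (sym (left-balance m 1≤m m≤n)) (≤-trans (≤-reflexive (𝟙-no (H ≤? m) (<⇒≱ m<H))) z≤n)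
  left-nondecreasing m 1≤m m≤n (inj₂ m<L) =
    balance-≤ (sym (left-balance m 1≤m m≤n)) (≤-trans (𝟙≤1 (H ≤? m)) (excessL-pos m 1≤m m<L))

  left-decreasing : ∀ m → 1 ≤ m → m ≤ n → H ≤ m → L ≤ m → f (suc m) < f m
  left-decreasing m 1≤m m≤n H≤m L≤m =
    balance-< (left-balance m 1≤m m≤n)
              (≤-trans (s≤s (≤-reflexive (excessL-zero m L≤m))) (≤-reflexive (sym (𝟙-yes (H ≤? m) H≤m))))

  left-nonincreasing : ∀ m → 1 ≤ m → m ≤ n → L ≤ m → f (suc m) ≤ f m
  left-nonincreasing m 1≤m m≤n L≤m =
    balance-≤ (left-balance m 1≤m m≤n) (≤-trans (≤-reflexive (excessL-zero m L≤m)) z≤n)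

  module _ (R⊓K≤H : R ⊓ K ≤ H) where

    private
      ⊓-reached : K ≤ R ⊓ K ⊎ R ≤ R ⊓ K
      ⊓-reached with ⊓-sel R K
      ... | inj₁ e = inj₂ (≤-reflexive (sym e))
      ... | inj₂ e = inj₁ (≤-reflexive (sym e))

    -- If L < min(R, K), f would both increase (right) and not increase (left) at L.
    min-below-L : R ⊓ K ≤ L
    min-below-L with R ⊓ K ≤? L
    ... | yes ≤L = ≤L
    ... | no  ≰L = ⊥-elim (<⇒≱ (right-increasing L 1≤L L≤n (<-≤-trans (≰⇒> ≰L) (m⊓n≤n R K))
                                                          (<-≤-trans (≰⇒> ≰L) (m⊓n≤m R K)))
                              (left-nonincreasing L 1≤L L≤n ≤-refl))

    -- If min(L, H) > min(R, K), f would increase (left) and not increase (right) at min(R, K).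
    min-above-⊓ : L ⊓ H ≤ R ⊓ K
    min-above-⊓ with L ⊓ H ≤? R ⊓ K
    ... | yes ≤m = ≤m
    ... | no  ≰m = ⊥-elim (<⇒≱ (left-increasing (R ⊓ K) (⊓-glb 1≤R 1≤K) (≤-trans (m⊓n≤m R K) R≤n)
                                                (<-≤-trans (≰⇒> ≰m) (m⊓n≤n L H))
                                                (<-≤-trans (≰⇒> ≰m) (m⊓n≤m L H)))
                              (right-nonincreasing (R ⊓ K) (⊓-glb 1≤R 1≤K) (≤-trans (m⊓n≤m R K) R≤n) ⊓-reached))

    -- If max(L, H) < max(R, K), f would decrease (left) and not decrease (right) at max(L, H).
    max-below : R ⊔ K ≤ L ⊔ H
    max-below with R ⊔ K ≤? L ⊔ H
    ... | yes ≤M = ≤M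
    ... | no  ≰M = ⊥-elim (<⇒≱ (left-decreasing (L ⊔ H) (≤-trans 1≤L (m≤m⊔n L H)) (⊔-lub L≤n H≤n)
                                                (m≤n⊔m L H) (m≤m⊔n L H))
                              (right-nondecreasing (L ⊔ H) (≤-trans 1≤L (m≤m⊔n L H)) (⊔-lub L≤n H≤n) below))
      where
      below : L ⊔ H < K ⊎ L ⊔ H < R
      below with ⊔-sel R K
      ... | inj₁ e = inj₂ (subst (L ⊔ H <_) e (≰⇒> ≰M))
      ... | inj₂ e = inj₁ (subst (L ⊔ H <_) e (≰⇒> ≰M))

    -- If max(R, K) < max(L, H), f would decrease (right) and not decrease (left) at max(R, K).
    max-above : L ⊔ H ≤ R ⊔ K
    max-above with L ⊔ H ≤? R ⊔ K
    ... | yes ≤M = ≤M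
    ... | no  ≰M = ⊥-elim (<⇒≱ (right-decreasing (R ⊔ K) (≤-trans 1≤R (m≤m⊔n R K)) (⊔-lub R≤n K≤n)
                                                 (m≤n⊔m R K) (m≤m⊔n R K))
                              (left-nondecreasing (R ⊔ K) (≤-trans 1≤R (m≤m⊔n R K)) (⊔-lub R≤n K≤n) below))
      where
      below : R ⊔ K < H ⊎ R ⊔ K < L
      below with ⊔-sel L H
      ... | inj₁ e = inj₂ (subst (R ⊔ K <_) e (≰⇒> ≰M))
      ... | inj₂ e = inj₁ (subst (R ⊔ K <_) e (≰⇒> ≰M))

    min-equal : R ⊓ K ≡ L ⊓ H
    min-equal = ≤-antisym (⊓-glb min-below-L R⊓K≤H) min-above-⊓

    sum-equal : L + H ≡ R + K
    sum-equal = begin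
      L + H              ≡⟨ m⊓n+m⊔n≡m+n L H ⟨
      L ⊓ H + (L ⊔ H)    ≡⟨ cong₂ _+_ (sym min-equal) (≤-antisym max-above max-below) ⟩
      R ⊓ K + (R ⊔ K)    ≡⟨ m⊓n+m⊔n≡m+n R K ⟩
      R + K              ∎
      where open ≡-Reasoning

module PrefixBound {A : Set} (_≟_ : DecidableEquality A) (v : List A) where
  open FactorSets _≟_
  open RightExtensions _≟_ v

  module _ (p' : List A) (c : A) (t : List A) (v≡p'ct : v ≡ p' ++ c ∷ t)
           (only-at-start : ∀ q s → v ≡ q ++ (p' ++ [ c ]) ++ s → length q ≡ 0) where

    next-letter : ∀ q z s → v ≡ q ++ p' ++ z ∷ s → length q ≢ 0 → z ≢ c × Factor (p' ++ [ z ]) v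
    next-letter q z s e q≢0 = (λ { refl → q≢0 (only-at-start q s e′) }) , q , s , e′
      where
      e′ : v ≡ q ++ (p' ++ [ z ]) ++ s
      e′ = trans e (cong (q ++_) (sym (++-assoc p' [ z ] s)))

    -- If neither p' nor the suffixes of length |p'| + 1 are unique, p' has a
    -- right extension other than c: follow a second occurrence of p', and if
    -- that one ends v, a second occurrence of the suffix x p' ending it.
    second-extension : ¬ UniquePrefixOfLength v (length p') → ¬ UniqueSuffixOfLength v (suc (length p')) →
                       Σ A λ z → z ≢ c × Factor (p' ++ [ z ]) v
    second-extension notPre notSuf
      with another-occurrence p' v [] (c ∷ t) v≡p'ct (λ once → notPre (p' , refl , (c ∷ t , v≡p'ct) , once))
    ... | q , z ∷ s , e , q≢0 = z , next-letter q z s e q≢0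
    ... | q , [] , e , q≢0 with initLast q
    ...   | [] = ⊥-elim (q≢0 refl)
    ...   | q₀ ∷ʳ′ x = at-end q₀ x (trans e (++-assoc q₀ [ x ] (p' ++ [])))
      where
      at-end : ∀ q₀ x → v ≡ q₀ ++ (x ∷ p') ++ [] → Σ A λ z → z ≢ c × Factor (p' ++ [ z ]) v
      at-end q₀ x v≡q₀xp'
        with another-occurrence (x ∷ p') v q₀ [] v≡q₀xp'
               (λ once → notSuf (x ∷ p' , refl , (q₀ , trans v≡q₀xp' (cong (q₀ ++_) (++-identityʳ (x ∷ p')))) , once))
      ... | q₃ , [] , e₃ , q₃≢q₀ =
        ⊥-elim (q₃≢q₀ (+-cancelʳ-≡ _ _ _ (length-++-≡ q₃ (x ∷ p' ++ []) q₀ (x ∷ p' ++ [])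
                                            (trans (sym e₃) v≡q₀xp'))))
      ... | q₃ , z ∷ s₃ , e₃ , _ =
        z , next-letter (q₃ ++ [ x ]) z s₃ (trans e₃ (sym (++-assoc q₃ [ x ] (p' ++ z ∷ s₃))))
                        (λ l → 0≢1+n (trans (sym l) (length-snoc q₃ x)))

  -- With excess m ≤ 1 and H_v = m + 1, one of R_v, K_v is at most m + 1.  Otherwise
  -- the prefix p' of length m is right special (previous lemma), a right special
  -- factor y t' of length m + 1 forces t' = p' (excess ≤ 1), and then p' has
  -- the three right extensions c and those of y p', which differ from c.
  prefix-bound : ∀ m R K → excess m ≤ 1 → IsH v (suc m) → IsR v R → IsK v K →
                 suc m < R → suc m < K → ⊥
  prefix-bound m R K ≤1 ((p , |p| , (t , v≡pt) , (_ , _ , _ , once)) , shorter) (_ , _ , specials) (_ , notSuf) m<R m<K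
    with split-last p m |p|
  ... | p' , c , refl , |p'| with specials (suc m) (s≤s z≤n) m<R
  ... | y ∷ t' , |t'| , x₁ , x₂ , x₁≢x₂ , f₁ , f₂ =
    excess≤1⇒no-three m p' c x₁ x₂ ≤1 |p'| (not-c x₁ f₁) (not-c x₂ f₂) (λ e → x₁≢x₂ (sym e))
                      ([] , t , v≡pt) (drop-y x₁ f₁) (drop-y x₂ f₂)
    where
    only-at-start : ∀ q s → v ≡ q ++ (p' ++ [ c ]) ++ s → length q ≡ 0
    only-at-start q s e = trans (once q s e) (sym (once [] t v≡pt))
    second : Σ A λ z → z ≢ c × Factor (p' ++ [ z ]) v
    second = second-extension p' c t (trans v≡pt (++-assoc p' [ c ] t)) only-at-start
               (λ u → shorter (length p') (subst (_< suc m) (sym |p'|) ≤-refl) u)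
               (subst (λ k → ¬ UniqueSuffixOfLength v (suc k)) (sym |p'|) (notSuf (suc m) m<K))
    t'≡p' : t' ≡ p'
    t'≡p' with second
    ... | z , z≢c , fz = excess≤1⇒unique m t' p' ≤1 (suc-injective |t'|) |p'|
                           (x₁ , x₂ , x₁≢x₂ , suffix-Factor y (t' ++ [ x₁ ]) f₁ , suffix-Factor y (t' ++ [ x₂ ]) f₂)
                           (c , z , (λ e → z≢c (sym e)) , ([] , t , v≡pt) , fz)
    drop-y : ∀ x → Factor ((y ∷ t') ++ [ x ]) v → Factor (p' ++ [ x ]) v
    drop-y x f = subst (λ w → Factor (w ++ [ x ]) v) t'≡p' (suffix-Factor y (t' ++ [ x ]) f)
    not-c : ∀ x → Factor ((y ∷ t') ++ [ x ]) v → x ≢ c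
    not-c x (a , b , e) refl = 0≢1+n (trans (sym (only-at-start (a ++ [ y ]) b e′)) (length-snoc a y))
      where
      e′ : v ≡ (a ++ [ y ]) ++ (p' ++ [ x ]) ++ b
      e′ = trans e (trans (cong (λ w → a ++ (y ∷ w ++ [ x ]) ++ b) t'≡p') (sym (++-assoc a [ y ] _)))

-- Alphabet sizes and letter counts

module Letters {A : Set} (_≟_ : DecidableEquality A) where
  open import Data.List.Membership.DecPropositional _≟_ using (_∈?_)

  α : List A → ℕ
  α = alphSize _≟_

  occ : A → List A → ℕ
  occ = count _≟_

  private
    others : A → List A → List A
    others x = filter (λ y → ¬? (x ≟ y))

    others-∈ : (x : A) (ys : List A) → Unique ys → x ∈ ys → suc (length (others x ys)) ≡ length ys
    others-∈ x (y ∷ ys) (y∉ ∷ _) (here refl) rewrite filter-reject (λ y → ¬? (x ≟ y)) {y} {ys} (λ x≢x → x≢x refl) =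
      cong (λ zs → suc (length zs)) (filter-all (λ y → ¬? (x ≟ y)) y∉)
    others-∈ x (y ∷ ys) (y∉ ∷ uys) (there p) with x ≟ y
    ... | yes refl = ⊥-elim (All¬⇒¬Any y∉ p)
    ... | no _     = cong suc (others-∈ x ys uys p)

    others-∉ : (x : A) (ys : List A) → x ∉ ys → others x ys ≡ ys
    others-∉ x ys x∉ = filter-all (λ y → ¬? (x ≟ y)) (All.tabulate (λ {z} z∈ x≡z → x∉ (subst (_∈ ys) (sym x≡z) z∈)))

  α-∷-∈ : (x : A) (xs : List A) → x ∈ xs → α (x ∷ xs) ≡ α xs
  α-∷-∈ x xs x∈ = others-∈ x (deduplicate _≟_ xs) (deduplicate-! _≟_ xs) (∈-deduplicate⁺ _≟_ x∈)

  α-∷-∉ : (x : A) (xs : List A) → x ∉ xs → α (x ∷ xs) ≡ suc (α xs)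
  α-∷-∉ x xs x∉ = cong (λ zs → suc (length zs)) (others-∉ x (deduplicate _≟_ xs) (λ p → x∉ (∈-deduplicate⁻ _≟_ xs p)))

  α-∷-≤ : (x : A) (xs : List A) → α (x ∷ xs) ≤ suc (α xs)
  α-∷-≤ x xs = s≤s (length-filter (λ y → ¬? (x ≟ y)) (deduplicate _≟_ xs))

  α≤length : (xs : List A) → α xs ≤ length xs
  α≤length []       = z≤n
  α≤length (x ∷ xs) = ≤-trans (α-∷-≤ x xs) (s≤s (α≤length xs))

  α-++-≤ : (xs ys : List A) → α (xs ++ ys) ≤ length xs + α ys
  α-++-≤ []       ys = ≤-refl
  α-++-≤ (x ∷ xs) ys = ≤-trans (α-∷-≤ x (xs ++ ys)) (s≤s (α-++-≤ xs ys))

  α-++-disjoint : (xs ys : List A) → (∀ a → a ∈ xs → a ∈ ys → ⊥) → α (xs ++ ys) ≡ α xs + α ys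
  α-++-disjoint []       ys _        = refl
  α-++-disjoint (x ∷ xs) ys disjoint with x ∈? xs
  ... | yes x∈xs = trans (α-∷-∈ x (xs ++ ys) (∈-++⁺ˡ x∈xs))
                         (trans (α-++-disjoint xs ys (λ a p q → disjoint a (there p) q))
                                (cong (_+ α ys) (sym (α-∷-∈ x xs x∈xs))))
  ... | no  x∉xs = trans (α-∷-∉ x (xs ++ ys) x∉xs++ys)
                         (trans (cong suc (α-++-disjoint xs ys (λ a p q → disjoint a (there p) q)))
                                (cong (_+ α ys) (sym (α-∷-∉ x xs x∉xs))))
    where
    x∉xs++ys : x ∉ xs ++ ys
    x∉xs++ys p with ∈-++⁻ xs p
    ... | inj₁ p₁ = x∉xs p₁
    ... | inj₂ p₂ = disjoint x (here refl) p₂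

  occ-++ : (a : A) (xs ys : List A) → occ a (xs ++ ys) ≡ occ a xs + occ a ys
  occ-++ a xs ys = trans (cong length (filter-++ (a ≟_) xs ys)) (length-++ (filter (a ≟_) xs))

  occ-∈ : (a : A) (xs : List A) → a ∈ xs → 1 ≤ occ a xs
  occ-∈ a (x ∷ xs) (here refl) rewrite filter-accept (a ≟_) {a} {xs} refl = s≤s z≤n
  occ-∈ a (x ∷ xs) (there p) with a ≟ x
  ... | yes refl = s≤s z≤n
  ... | no  _    = occ-∈ a xs p

  occ-∉ : (a : A) (xs : List A) → a ∉ xs → occ a xs ≡ 0
  occ-∉ a xs a∉ = cong length (filter-none (a ≟_) (All.tabulate (λ {z} z∈ a≡z → a∉ (subst (_∈ xs) (sym a≡z) z∈))))

  occ-∷ : (a : A) (xs : List A) → occ a (a ∷ xs) ≡ suc (occ a xs)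
  occ-∷ a xs rewrite filter-accept (a ≟_) {a} {xs} refl = refl

  occ⇒∈ : (a : A) (xs : List A) → 1 ≤ occ a xs → a ∈ xs
  occ⇒∈ a xs 1≤ with a ∈? xs
  ... | yes a∈ = a∈
  ... | no  a∉ = ⊥-elim (<⇒≱ 1≤ (≤-reflexive (occ-∉ a xs a∉)))

  occ-≥2 : (a : A) (w pre xs ys : List A) → w ≡ pre ++ xs ++ ys → a ∈ xs → a ∈ ys → 2 ≤ occ a w
  occ-≥2 a w pre xs ys refl a∈xs a∈ys =
    ≤-trans (+-mono-≤ (occ-∈ a xs a∈xs) (occ-∈ a ys a∈ys))
            (≤-trans (≤-reflexive (sym (occ-++ a xs ys)))
                     (≤-trans (m≤n+m _ _) (≤-reflexive (sym (occ-++ a pre (xs ++ ys))))))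

  repeated-letter : (w : List A) (x : A) (p₁ s₁ p₂ s₂ : List A) → w ≡ p₁ ++ x ∷ s₁ → w ≡ p₂ ++ x ∷ s₂ →
                    length p₁ < length p₂ → α w < length w
  repeated-letter w x p₁ s₁ p₂ s₂ e₁ e₂ p₁<p₂
    with prefix-split p₁ (x ∷ s₁) p₂ (x ∷ s₂) (trans (sym e₁) e₂) (<⇒≤ p₁<p₂)
  ... | [] , p₂≡ = ⊥-elim (<⇒≢ p₁<p₂ (cong length (trans (sym (++-identityʳ p₁)) (sym p₂≡))))
  ... | g ∷ gs , refl with ++-cancelˡ p₁ (x ∷ s₁) ((g ∷ gs) ++ x ∷ s₂) (trans (sym e₁) (trans e₂ (++-assoc p₁ (g ∷ gs) (x ∷ s₂))))
  ... | refl = subst (λ z → α z < length z) (sym e₁)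
    (≤-<-trans (α-++-≤ p₁ (x ∷ gs ++ x ∷ s₂))
      (≤-<-trans (+-monoʳ-≤ (length p₁) (≤-trans (≤-reflexive (α-∷-∈ x (gs ++ x ∷ s₂) (∈-++⁺ʳ gs (here refl))))
                                                 (α≤length (gs ++ x ∷ s₂))))
                 (≤-reflexive (trans (sym (+-suc (length p₁) _)) (sym (length-++ p₁))))))

-- The heart of w: w = r v s where r and s consist of letters occurring once in w.

module HeartOf {A : Set} (_≟_ : DecidableEquality A) (w : List A) where
  open Letters _≟_

  Single : A → Set
  Single a = occ a w ≡ 1

  single? : (a : A) → Dec (Single a)
  single? a = occ a w Data.Nat.≟ 1

  r s : List A
  r = takeWhile single? w
  s = reverse (takeWhile single? (reverse w))

  singles-distinct : (pre xs post : List A) → w ≡ pre ++ xs ++ post → All Single xs → α xs ≡ length xs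
  singles-distinct pre []       post _ _ = refl
  singles-distinct pre (x ∷ xs) post e (single-x ∷ singles) =
    trans (α-∷-∉ x xs x∉xs) (cong suc (singles-distinct (pre ++ [ x ]) xs post e′ singles))
    where
    e′ : w ≡ (pre ++ [ x ]) ++ xs ++ post
    e′ = trans e (sym (++-assoc pre [ x ] (xs ++ post)))
    x∉xs : x ∉ xs
    x∉xs x∈xs = <⇒≢ (occ-≥2 x w pre [ x ] (xs ++ post) e (here refl) (∈-++⁺ˡ x∈xs)) (sym single-x)

  heart-yes : α w < length w → heart _≟_ w ≡ drop (length r) (take (length w ∸ length s) w)
  heart-yes lt with alphSize _≟_ w Data.Nat.<? length w
  ... | yes _ = refl
  ... | no ¬lt = ⊥-elim (¬lt lt)

  heart-no : ¬ (α w < length w) → heart _≟_ w ≡ w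
  heart-no ¬lt with alphSize _≟_ w Data.Nat.<? length w
  ... | yes lt = ⊥-elim (¬lt lt)
  ... | no _   = refl

  module Trimmed (r′ mid s′ : List A) (w≡ : w ≡ r′ ++ mid ++ s′)
                 (singles-r : All Single r′) (singles-s : All Single s′) where

    -- The trimmed letters are exactly the letters lost from the alphabet.
    length-alphabet : length w + α mid ≡ length mid + α w
    length-alphabet = begin
      length w + α mid                                ≡⟨ cong (_+ α mid) |w| ⟩
      length r′ + (length mid + length s′) + α mid    ≡⟨ rearrange (length r′) (length mid) (length s′) (α mid) ⟩
      length mid + (length r′ + (α mid + length s′))  ≡⟨ cong (length mid +_) (sym αw) ⟩
      length mid + α w                                ∎
      where
      open ≡-Reasoning
      rearrange : ∀ a b c d → a + (b + c) + d ≡ b + (a + (d + c))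
      rearrange = solve-∀
      |w| : length w ≡ length r′ + (length mid + length s′)
      |w| = trans (cong length w≡) (trans (length-++ r′) (cong (length r′ +_) (length-++ mid)))
      w≡′ : w ≡ (r′ ++ mid) ++ s′ ++ []
      w≡′ = trans w≡ (trans (sym (++-assoc r′ mid s′)) (cong ((r′ ++ mid) ++_) (sym (++-identityʳ s′))))
      αw : α w ≡ length r′ + (α mid + length s′)
      αw = trans (cong α w≡)
        (trans (α-++-disjoint r′ (mid ++ s′) (λ a p q → <⇒≢ (occ-≥2 a w [] r′ (mid ++ s′) w≡ p q) (sym (All.lookup singles-r p))))
          (cong₂ _+_ (singles-distinct [] r′ (mid ++ s′) w≡ singles-r)
            (trans (α-++-disjoint mid s′ (λ a p q → <⇒≢ (occ-≥2 a w r′ mid s′ w≡ p q) (sym (All.lookup singles-s q))))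
                   (cong (α mid +_) (singles-distinct (r′ ++ mid) s′ [] w≡′ singles-s)))))

    repeated-in-mid : (x : A) (mid' : List A) → mid ≡ x ∷ mid' → ¬ Single x → x ∈ mid'
    repeated-in-mid x mid' refl ¬single = occ⇒∈ x mid' (≤-pred (subst (2 ≤_) (occ-∷ x mid') two-in-mid))
      where
      x∈w : x ∈ w
      x∈w = subst (x ∈_) (sym w≡) (∈-++⁺ʳ r′ (here refl))
      outside : ∀ {zs} → All Single zs → occ x zs ≡ 0
      outside singles = occ-∉ x _ (λ p → ¬single (All.lookup singles p))
      two-in-mid : 2 ≤ occ x mid
      two-in-mid = subst (2 ≤_)
        (trans (cong (occ x) w≡) (trans (occ-++ x r′ (mid ++ s′))
          (trans (cong₂ _+_ (outside singles-r) (trans (occ-++ x mid s′) (cong (occ x mid +_) (outside singles-s))))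
                 (+-identityʳ _))))
        (≤∧≢⇒< (occ-∈ x w x∈w) (λ e → ¬single (sym e)))

  singles-r : All Single r
  singles-r = all-takeWhile single? w

  singles-s : All Single s
  singles-s = All.tabulate (λ p → All.lookup (all-takeWhile single? (reverse w)) (reverse⁻ p))

  dropWhile-head : ∀ xs {x xs'} → dropWhile single? xs ≡ x ∷ xs' → ¬ Single x
  dropWhile-head xs e with subst (λ z → Maybe.All (∁ Single) (head z)) e (all-head-dropWhile single? xs)
  ... | Maybe.just ¬single = ¬single

  r-before : (x : A) (d : List A) (e : List A) (y : A) → w ≡ r ++ x ∷ d → w ≡ (e ++ [ y ]) ++ s →
             ¬ Single y → length r < length (e ++ [ y ])
  r-before x d e y w≡rxd w≡gs ¬single-y with length (e ++ [ y ]) ≤? length r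
  ... | no  g≰r = ≰⇒> g≰r
  ... | yes g≤r with prefix-split (e ++ [ y ]) s r (x ∷ d) (trans (sym w≡gs) w≡rxd) g≤r
  ... | _ , r≡g++ = ⊥-elim (¬single-y (All.lookup singles-r
                      (subst (y ∈_) (sym r≡g++) (∈-++⁺ˡ (∈-++⁺ʳ e (here refl))))))

  middle : (x : A) (d g : List A) → w ≡ r ++ x ∷ d → w ≡ g ++ s → ¬ Single x →
           length r < length g → α w < length w →
           Σ A λ x₀ → Σ (List A) λ mid' → w ≡ r ++ (x₀ ∷ mid') ++ s × ¬ Single x₀ × heart _≟_ w ≡ x₀ ∷ mid'
  middle x d g w≡rxd w≡gs ¬single-x r<g lt with prefix-split r (x ∷ d) g s (trans (sym w≡rxd) w≡gs) (<⇒≤ r<g)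
  ... | [] , g≡r++[] = ⊥-elim (<⇒≢ r<g (sym (cong length (trans g≡r++[] (++-identityʳ r)))))
  ... | x₀ ∷ mid' , g≡r++mid = x₀ , mid' , w≡rms , ¬single-x₀ , heart≡mid
    where
    mid : List A
    mid = x₀ ∷ mid'
    w≡rms : w ≡ r ++ mid ++ s
    w≡rms = trans w≡gs (trans (cong (_++ s) g≡r++mid) (++-assoc r mid s))
    ¬single-x₀ : ¬ Single x₀
    ¬single-x₀ = subst (λ z → ¬ Single z) (proj₁ (∷-injective (++-cancelˡ r _ _ (trans (sym w≡rxd) w≡rms)))) ¬single-x
    |w|∸|s| : length w ∸ length s ≡ length g
    |w|∸|s| = trans (cong (λ z → length z ∸ length s) w≡gs)
                    (trans (cong (_∸ length s) (length-++ g)) (m+n∸n≡m (length g) (length s)))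
    heart≡mid : heart _≟_ w ≡ mid
    heart≡mid = trans (heart-yes lt) (begin
      drop (length r) (take (length w ∸ length s) w)  ≡⟨ cong (λ k → drop (length r) (take k w)) |w|∸|s| ⟩
      drop (length r) (take (length g) w)             ≡⟨ cong (λ z → drop (length r) (take (length g) z)) w≡gs ⟩
      drop (length r) (take (length g) (g ++ s))      ≡⟨ cong (drop (length r)) (take-++ g s) ⟩
      drop (length r) g                               ≡⟨ cong (drop (length r)) g≡r++mid ⟩
      drop (length r) (r ++ mid)                      ≡⟨ drop-++ r mid ⟩
      mid                                             ∎)
      where open ≡-Reasoning

  not-all-single : α w < length w → ¬ All Single w
  not-all-single lt all = <⇒≢ lt (singles-distinct [] w [] (sym (++-identityʳ w)) all)

  decomposition : α w < length w →
                  Σ A λ x₀ → Σ (List A) λ mid' → w ≡ r ++ (x₀ ∷ mid') ++ s × ¬ Single x₀ × heart _≟_ w ≡ x₀ ∷ mid'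
  decomposition lt with dropWhile single? w in e₁ | dropWhile single? (reverse w) in e₂
  ... | []    | _     = ⊥-elim (not-all-single lt (dropWhile⁻ single? e₁))
  ... | _ ∷ _ | []    = ⊥-elim (not-all-single lt (All.tabulate (λ p → All.lookup (dropWhile⁻ single? e₂) (reverse⁺ p))))
  ... | x ∷ d | y ∷ e =
    middle x d (reverse e ++ [ y ]) w≡rxd w≡gs (dropWhile-head w e₁)
           (r-before x d (reverse e) y w≡rxd w≡gs (dropWhile-head (reverse w) e₂)) lt
    where
    w≡rxd : w ≡ r ++ x ∷ d
    w≡rxd = sym (trans (cong (r ++_) (sym e₁)) (takeWhile++dropWhile single? w))
    w≡gs : w ≡ (reverse e ++ [ y ]) ++ s
    w≡gs = trans (sym (reverse-involutive w))
      (trans (cong reverse (sym (trans (cong (takeWhile single? (reverse w) ++_) (sym e₂))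
                                       (takeWhile++dropWhile single? (reverse w)))))
             (trans (reverse-++ (takeWhile single? (reverse w)) (y ∷ e)) (cong (_++ s) (reverse-++ [ y ] e))))

module _ {A : Set} (_≟_ : DecidableEquality A) where
  open Letters _≟_

  repeated-first⇒2≤H : (x : A) (v' : List A) → x ∈ v' → ∀ H → IsH (x ∷ v') H → 2 ≤ H
  repeated-first⇒2≤H x v' _ zero (([] , _ , _ , once) , _) = ⊥-elim (empty-not-once (x ∷ v') (λ ()) once)
  repeated-first⇒2≤H x v' _ zero ((_ ∷ _ , () , _) , _)
  repeated-first⇒2≤H x v' x∈v' (suc zero) ((_ ∷ [] , _ , (_ , refl) , (_ , _ , _ , once)) , _)
    with ∈-∃++ x∈v'
  ... | g , h , refl = ⊥-elim (0≢1+n (trans (once [] (g ++ [ x ] ++ h) refl) (sym (once (x ∷ g) h refl))))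
  repeated-first⇒2≤H x v' _ (suc zero) ((_ ∷ _ ∷ _ , () , _) , _)
  repeated-first⇒2≤H x v' _ (suc (suc H)) _ = s≤s (s≤s z≤n)

  -- In a word without repeated letters no letter is right special, so R = 1.
  distinct⇒R≡1 : (w : List A) → ¬ (α w < length w) → ∀ R → IsR w R → R ≡ 1
  distinct⇒R≡1 w distinct R (1≤R , _ , specials) with R Data.Nat.≟ 1
  ... | yes R≡1 = R≡1
  ... | no  R≢1 with specials 1 ≤-refl (≤∧≢⇒< 1≤R (λ e → R≢1 (sym e)))
  ... | x ∷ [] , _ , a , b , a≢b , (p₁ , q₁ , e₁) , (p₂ , q₂ , e₂) with <-cmp (length p₁) (length p₂)
  ... | tri< p₁<p₂ _ _ = ⊥-elim (distinct (repeated-letter w x p₁ (a ∷ q₁) p₂ (b ∷ q₂) e₁ e₂ p₁<p₂))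
  ... | tri> _ _ p₂<p₁ = ⊥-elim (distinct (repeated-letter w x p₂ (b ∷ q₂) p₁ (a ∷ q₁) e₂ e₁ p₂<p₁))
  ... | tri≈ _ same _ with prefix-unique p₁ (x ∷ a ∷ q₁) p₂ (x ∷ b ∷ q₂) (trans (sym e₁) e₂) same
  ... | refl = ⊥-elim (a≢b (proj₁ (∷-injective (∷-injectiveʳ (++-cancelˡ p₁ _ _ (trans (sym e₁) e₂))))))

  heart-facts : (w : List A) → w ≢ [] → ∀ {R H} → IsR (heart _≟_ w) R → IsH (heart _≟_ w) H →
                heart _≟_ w ≢ [] ×
                length w + α (heart _≟_ w) ≡ length (heart _≟_ w) + α w ×
                (2 ≤ H ⊎ R ≡ 1)
  heart-facts w w≢[] {R} {H} isR isH = by-cases (α w <? length w)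
    where
    open HeartOf _≟_ w using (decomposition; heart-no; r; s; singles-r; singles-s; module Trimmed)
    by-cases : Dec (α w < length w) →
               heart _≟_ w ≢ [] × length w + α (heart _≟_ w) ≡ length (heart _≟_ w) + α w × (2 ≤ H ⊎ R ≡ 1)
    by-cases (yes lt) with decomposition lt
    ... | x₀ , mid' , w≡ , ¬single , heart≡ =
      subst (_≢ []) (sym heart≡) (λ ()) ,
      subst (λ v → length w + α v ≡ length v + α w) (sym heart≡) (Trimmed.length-alphabet r (x₀ ∷ mid') s w≡ singles-r singles-s) ,
      inj₁ (repeated-first⇒2≤H x₀ mid' (Trimmed.repeated-in-mid r (x₀ ∷ mid') s w≡ singles-r singles-s x₀ mid' refl ¬single)
                                H (subst (λ v → IsH v H) heart≡ isH))
    by-cases (no ¬lt) rewrite heart-no ¬lt = w≢[] , refl , inj₂ (distinct⇒R≡1 w ¬lt R isR)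

-- The theorem for a single word v with n + 2 = R + K + α (n = |v|): the
-- complexity of v satisfies the hypotheses of the arithmetic core, with the
-- left balance obtained from the right one applied to the reversal of v.
module ExtremalWord {A : Set} (_≟_ : DecidableEquality A) (v : List A) (v≢[] : v ≢ [])
  {R K L H : ℕ} (isR : IsR v R) (isK : IsK v K) (isL : IsL v L) (isH : IsH v H)
  (extremal : length v + 2 ≡ R + K + alphSize _≟_ v) where

  open FactorSets _≟_ using (complexity)
  module Right = RightExtensions _≟_ v
  module Left  = RightExtensions _≟_ (reverse v)

  n : ℕ
  n = length v

  1≤n : 1 ≤ n
  1≤n = nonempty-length v v≢[]

  isR′ : IsR (reverse v) L
  isR′ = IsL⇒IsR-reverse isL

  isK′ : IsK (reverse v) H
  isK′ = IsH⇒IsK-reverse isH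

  |v′| : length (reverse v) ≡ n
  |v′| = length-reverse v

  L≤n : L ≤ n
  L≤n = subst (L ≤_) |v′| (R≤length isR′ (subst (1 ≤_) (sym |v′|) 1≤n))

  H≤n : H ≤ n
  H≤n = subst (H ≤_) |v′| (K≤length isK′)

  right-balance : ∀ m → 1 ≤ m → m ≤ n → complexity v (suc m) + 𝟙 (K ≤? m) ≡ complexity v m + Right.excess m
  right-balance m _ m≤n = trans (cong (complexity v (suc m) +_) (sym (Right.deadEnds-≡ K m isK m≤n))) (Right.balance m)

  left-balance : ∀ m → 1 ≤ m → m ≤ n → complexity v (suc m) + 𝟙 (H ≤? m) ≡ complexity v m + Left.excess m
  left-balance m _ m≤n = begin
    complexity v (suc m) + 𝟙 (H ≤? m)                   ≡⟨ cong (_+ 𝟙 (H ≤? m)) (complexity-reverse _≟_ v (suc m)) ⟨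
    complexity (reverse v) (suc m) + 𝟙 (H ≤? m)         ≡⟨ cong (complexity (reverse v) (suc m) +_)
                                                              (sym (Left.deadEnds-≡ H m isK′ (subst (m ≤_) (sym |v′|) m≤n))) ⟩
    complexity (reverse v) (suc m) + Left.deadEnds m    ≡⟨ Left.balance m ⟩
    complexity (reverse v) m + Left.excess m            ≡⟨ cong (_+ Left.excess m) (complexity-reverse _≟_ v m) ⟩
    complexity v m + Left.excess m                      ∎
    where open ≡-Reasoning

  open ComplexityProfile n (alphSize _≟_ v) R K L H (complexity v) Right.excess Left.excess
    right-balance left-balance (complexity-one _≟_ v) (complexity-beyond _≟_ v)
    (λ m 1≤m m<R → Right.excess-pos m (proj₂ (proj₂ isR) m 1≤m m<R))
    (λ m 1≤m m<L → Left.excess-pos m (proj₂ (proj₂ isR′) m 1≤m m<L))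
    (λ m L≤m → Left.excess-zero m (no-RightSpecial-beyond m isR′ L≤m))
    (proj₁ isR) (1≤K isK v≢[]) (proj₁ isL)
    (R≤length isR 1≤n) (K≤length isK) L≤n H≤n
    extremal
    public

  -- min(R, K) ≤ H: trivially if R = 1; if H = m + 1 ≥ 2, the right excess at m
  -- is at most 1 and the prefix bound applies.
  min-below-H : 2 ≤ H ⊎ R ≡ 1 → R ⊓ K ≤ H
  min-below-H (inj₂ R≡1) = ≤-trans (m⊓n≤m R K) (subst (_≤ H) (sym R≡1) (1≤K isK′ (λ e → v≢[] (reverse-empty e))))
    where
    reverse-empty : reverse v ≡ [] → v ≡ []
    reverse-empty e = trans (sym (reverse-involutive v)) (cong reverse e)
  min-below-H (inj₁ 2≤H) with R ⊓ K ≤? H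
  ... | yes ≤H = ≤H
  ... | no  ≰H = ⊥-elim (PrefixBound.prefix-bound _≟_ v m R K excess≤1 (subst (IsH v) (sym m+1≡H) isH) isR isK
                           (subst (_< R) (sym m+1≡H) (<-≤-trans (≰⇒> ≰H) (m⊓n≤m R K)))
                           (subst (_< K) (sym m+1≡H) (<-≤-trans (≰⇒> ≰H) (m⊓n≤n R K))))
    where
    m : ℕ
    m = H ∸ 1
    m+1≡H : suc m ≡ H
    m+1≡H = trans (+-comm 1 m) (m∸n+n≡m (≤-trans (n≤1+n 1) 2≤H))
    excess≤1 : Right.excess m ≤ 1
    excess≤1 = subst (_≤ 1) (sym (excessR-exact m (≤-pred (subst (2 ≤_) (sym m+1≡H) 2≤H))
                                                 (≤-trans (n≤1+n m) (subst (_≤ n) (sym m+1≡H) H≤n))))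
                     (𝟙≤1 (m <? R))

-- |w| - |v| = α(w) - α(v) transports the extremality condition from w to v.
extremality-transfer : ∀ {|w| |v| αw αv c} → |w| + αv ≡ |v| + αw → 2 ≤ c + αw →
                       |w| ≡ c + αw ∸ 2 → |v| + 2 ≡ c + αv
extremality-transfer {|w|} {|v|} {αw} {αv} {c} trimmed 2≤ |w|≡ = +-cancelʳ-≡ αw _ _ (begin
  |v| + 2 + αw      ≡⟨ swap |v| 2 αw ⟩
  |v| + αw + 2      ≡⟨ cong (_+ 2) trimmed ⟨
  |w| + αv + 2      ≡⟨ swap |w| αv 2 ⟩
  |w| + 2 + αv      ≡⟨ cong (λ k → k + 2 + αv) |w|≡ ⟩
  c + αw ∸ 2 + 2 + αv ≡⟨ cong (_+ αv) (m∸n+n≡m 2≤) ⟩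
  c + αw + αv       ≡⟨ swap c αw αv ⟩
  c + αv + αw       ∎)
  where
  open ≡-Reasoning
  swap : ∀ a b d → a + b + d ≡ a + d + b
  swap = solve-∀

proposition2p12 : {A : Set} (_≟_ : DecidableEquality A) (w : List A) → w ≢ [] →
    (R K L H : ℕ) →
    IsR (heart _≟_ w) R → IsK (heart _≟_ w) K →
    IsL (heart _≟_ w) L → IsH (heart _≟_ w) H →
    length w ≡ R + K + alphSize _≟_ w ∸ 2 →
    (R ⊓ K ≡ L ⊓ H) × (length w ≡ L + H + alphSize _≟_ w ∸ 2)
proposition2p12 _≟_ w w≢[] R K L H isR isK isL isH |w|≡ with heart-facts _≟_ w w≢[] isR isH
... | v≢[] , trimmed , 2≤H⊎R≡1 =
  min-equal R⊓K≤H , trans |w|≡ (cong (λ k → k + alphSize _≟_ w ∸ 2) (sym (sum-equal R⊓K≤H)))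
  where
  extremal : length (heart _≟_ w) + 2 ≡ R + K + alphSize _≟_ (heart _≟_ w)
  extremal = extremality-transfer trimmed (≤-trans (+-mono-≤ (proj₁ isR) (1≤K isK v≢[])) (m≤m+n _ _)) |w|≡
  open ExtremalWord _≟_ (heart _≟_ w) v≢[] isR isK isL isH extremal using (min-below-H; min-equal; sum-equal)
  R⊓K≤H : R ⊓ K ≤ H
  R⊓K≤H = min-below-H 2≤H⊎R≡1
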